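{- QHC is a conservative extension of QS4, and therefore also of QC. Here formulas of QS4 are identified with c-formulas of QHC by reading $\Box$ as $?!$, and formulas of QC are identified with c-formulas containing no $?$ and no $!$. Precisely, for every rule or principle $R$ whose formulas are formulas of QS4 (respectively QC), $\vdash_{QHC}R$ holds if and only if $\vdash_{QS4}R$ (respectively $\vdash_{QC}R$).
   Context: Meta-logical framework. Formulas of a first-order language may contain individual variables and predicate variables. Meta-formulas are built from formulas using meta-conjunction $\&$, meta-implication $\Rightarrow$, and universal meta-quantifiers over individual and predicate variables. A principle $\cdot G$, for a formula $G$, is the meta-formula obtained by universally meta-quantifying all free individual variables of $G$ and then all predicate variables of $G$. A rule $F_1,\dots,F_m/G$ is the meta-formula $\forall^2(\forall^1F_1\,\&\cdots\&\,\forall^1F_m\Rightarrow\forall^1G)$, where $\forall^1$ meta-quantifies the free individual variables of the formula it precedes and $\forall^2$ meta-quantifies all predicate variables occurring. A logic $L$ is given by a derivation system $\mathcal D$, a meta-conjunction of finitely many principles and rules. For a meta-formula $\mathcal F$, $\vdash_L\mathcal F$ means that $\mathcal D\Rightarrow\mathcal F$ is derivable by the natural-deduction meta-rules: introduction and elimination of $\&$, $\Rightarrow$ and the universal meta-quantifiers (elimination allows substituting terms for individual variables and formulas for predicate variables), plus $\alpha$-conversion. Language of QHC. It has individual variables and, for each $n\ge0$, countably many $n$-ary problem variables $\alpha,\beta,\gamma,\delta,\theta,\dots$ and countably many $n$-ary proper predicate variables $p,q,\dots$. - A c-formula is $\top$, $\bot$, an atom $p(x_1,\dots,x_n)$, or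 $?\Phi$ for an i-formula $\Phi$, closed under the classical connectives $\land,\lor,\to,\leftrightarrow,\neg$ and quantifiers $\exists,\forall$. - An i-formula is $\checkmark$, $\curlywedge$ (absurdity), an atom $\alpha(x_1,\dots,x_n)$, or $!F$ for a c-formula $F$, closed under the intuitionistic connectives $\land,\lor,\to,\leftrightarrow,\neg$ (with $\neg\Phi:=\Phi\to\curlywedge$) and quantifiers $\exists,\forall$. Connectives applied to c-formulas are classical; those applied to i-formulas are intuitionistic. QHC is the logic whose derivation system consists of: - (0a) all laws and rules of classical predicate logic QC, for c-formulas; - (0b) all laws and rules of intuitionistic predicate logic QH, for i-formulas; - the principles $\cdot\,?(\gamma\land\delta)\leftrightarrow ?\gamma\land ?\delta$, $\cdot\,?(\gamma\lor\delta)\leftrightarrow ?\gamma\lor ?\delta$, $\cdot\,?(\gamma\to\delta)\to(?\gamma\to ?\delta)$, $\cdot\,\neg ?\curlywedge$, $\cdot\,?\exists x\,\theta(x)\leftrightarrow\exists x\,?\theta(x)$, $\cdot\,?\forall x\,\theta(x)\to\forall x\,?\theta(x)$, $\cdot\,\gamma\to\,!?\gamma$, $\cdot\,\neg !\bot$, $\cdot\,?!p\to p$, $\cdot\,!p\to\,!?!p$ and $\cdot\,!(p\to q)\to(!p\to !q)$; - the rules $!p/p$ and $p/!p$. QS4 is the extension of QC by a modal operator $\Box$ with the laws $\cdot\,\Box p\to p$, $\cdot\,\Box p\to\Box\Box p$ and $\cdot\,\Box(p\to q)\to(\Box p\to\Box q)$, and the rule $p/\Box p$. -}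

module Defs where

-- Individual variables and predicate variables are represented by de Bruijn
-- indices (so alpha-conversion is built in).  Terms are individual variables.

open import Data.Nat using (ℕ; zero; suc; _⊔_; pred; _<ᵇ_; _≡ᵇ_)
open import Data.Nat.Properties using () renaming (_≟_ to _≟ℕ_)
open import Data.Bool using (Bool; true; false; if_then_else_; _∧_; not)
open import Data.Vec using (Vec; []; _∷_) renaming (map to vmap; foldr′ to vfoldr)
open import Data.List using (List; []; _∷_; _++_; map; foldr; concatMap; replicate; deduplicate)
open import Data.List.NonEmpty using (List⁺; _∷_)
open import Data.List.Membership.Propositional using (_∈_)
open import Data.Product using (Σ; _,_; _×_)
open import Data.Product.Properties using (≡-dec)
open import Relation.Binary.Definitions using (DecidableEquality)
open import Relation.Binary.PropositionalEquality using (_≡_; refl)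
open import Relation.Nullary using (yes; no; does)

record Lang : Set₁ where
  field
    Sort  : Set
    _≟S_  : DecidableEquality Sort
    Const : Sort → Set
    Op    : Sort → Sort → Set      -- Op t s : operator taking a t-formula to an s-formula

module Syntax (L : Lang) where
  open Lang L

  -- Formulas of sort s.  'pv a k ts' is the predicate variable of sort s,
  -- arity a and de Bruijn index k (counted among binders of the same
  -- class (s , a)), applied to the individual variables ts.
  data Fm : Sort → Set where
    con  : ∀ {s} → Const s → Fm s
    pv   : ∀ {s} (a k : ℕ) → Vec ℕ a → Fm s
    op   : ∀ {t s} → Op t s → Fm t → Fm s
    _and_ : ∀ {s} → Fm s → Fm s → Fm s
    _or_  : ∀ {s} → Fm s → Fm s → Fm s
    _imp_ : ∀ {s} → Fm s → Fm s → Fm s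
    all  : ∀ {s} → Fm s → Fm s
    ex   : ∀ {s} → Fm s → Fm s

  infixr 6 _and_
  infixr 5 _or_
  infixr 4 _imp_

  _iff_ : ∀ {s} → Fm s → Fm s → Fm s
  F iff G = (F imp G) and (G imp F)

  sameClass : Sort → ℕ → Sort → ℕ → Bool
  sameClass s a s₀ a₀ = does (s ≟S s₀) ∧ does (a ≟ℕ a₀)

  lift : (ℕ → ℕ) → ℕ → ℕ
  lift ρ zero    = zero
  lift ρ (suc i) = suc (ρ i)

  liftN : ℕ → (ℕ → ℕ) → ℕ → ℕ
  liftN zero    ρ = ρ
  liftN (suc n) ρ = lift (liftN n ρ)

  ren : ∀ {s} → (ℕ → ℕ) → Fm s → Fm s
  ren ρ (con c)     = con c
  ren ρ (pv a k ts) = pv a k (vmap ρ ts)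
  ren ρ (op o F)    = op o (ren ρ F)
  ren ρ (F and G)   = ren ρ F and ren ρ G
  ren ρ (F or G)    = ren ρ F or ren ρ G
  ren ρ (F imp G)   = ren ρ F imp ren ρ G
  ren ρ (all F)     = all (ren (lift ρ) F)
  ren ρ (ex F)      = ex (ren (lift ρ) F)

  -- A substituend for an a-ary predicate variable is a formula whose
  -- individual variables 0 .. a-1 are the argument places and whose
  -- variables i ≥ a denote the free individual variable i - a.
  ambShift : ∀ {s} → ℕ → Fm s → Fm s
  ambShift a G = ren (liftN a suc) G

  pick : ∀ {a} → Vec ℕ a → ℕ → ℕ
  pick []       i       = i
  pick (t ∷ ts) zero    = t
  pick (t ∷ ts) (suc i) = pick ts i

  shiftP : ∀ {s} → Sort → ℕ → ℕ → Fm s → Fm s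
  shiftP s₀ a₀ cut (con c) = con c
  shiftP {s} s₀ a₀ cut (pv a k ts) =
    if sameClass s a s₀ a₀ ∧ not (k <ᵇ cut) then pv a (suc k) ts else pv a k ts
  shiftP s₀ a₀ cut (op o F)  = op o (shiftP s₀ a₀ cut F)
  shiftP s₀ a₀ cut (F and G) = shiftP s₀ a₀ cut F and shiftP s₀ a₀ cut G
  shiftP s₀ a₀ cut (F or G)  = shiftP s₀ a₀ cut F or shiftP s₀ a₀ cut G
  shiftP s₀ a₀ cut (F imp G) = shiftP s₀ a₀ cut F imp shiftP s₀ a₀ cut G
  shiftP s₀ a₀ cut (all F)   = all (shiftP s₀ a₀ cut F)
  shiftP s₀ a₀ cut (ex F)    = ex (shiftP s₀ a₀ cut F)

  substP : ∀ {s} (s₀ : Sort) (a₀ j : ℕ) → Fm s₀ → Fm s → Fm s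
  substP s₀ a₀ j G (con c) = con c
  substP {s} s₀ a₀ j G (pv a k ts) with s ≟S s₀ | a ≟ℕ a₀
  ... | yes refl | yes refl =
        if k <ᵇ j then pv a k ts
        else if k ≡ᵇ j then ren (pick ts) G
        else pv a (pred k) ts
  ... | _ | _ = pv a k ts
  substP s₀ a₀ j G (op o F)  = op o (substP s₀ a₀ j G F)
  substP s₀ a₀ j G (F and H) = substP s₀ a₀ j G F and substP s₀ a₀ j G H
  substP s₀ a₀ j G (F or H)  = substP s₀ a₀ j G F or substP s₀ a₀ j G H
  substP s₀ a₀ j G (F imp H) = substP s₀ a₀ j G F imp substP s₀ a₀ j G H
  substP s₀ a₀ j G (all F)   = all (substP s₀ a₀ j (ambShift a₀ G) F)
  substP s₀ a₀ j G (ex F)    = ex (substP s₀ a₀ j (ambShift a₀ G) F)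

  data MF : Set where
    fm   : ∀ {s} → Fm s → MF
    _&_  : MF → MF → MF
    _⟹_ : MF → MF → MF
    ∀¹   : MF → MF
    ∀²   : Sort → ℕ → MF → MF

  infixr 3 _&_
  infixr 2 _⟹_

  renM : (ℕ → ℕ) → MF → MF
  renM ρ (fm F)     = fm (ren ρ F)
  renM ρ (M & N)    = renM ρ M & renM ρ N
  renM ρ (M ⟹ N)   = renM ρ M ⟹ renM ρ N
  renM ρ (∀¹ M)     = ∀¹ (renM (lift ρ) M)
  renM ρ (∀² s a M) = ∀² s a (renM ρ M)

  inst0 : ℕ → ℕ → ℕ
  inst0 t zero    = t
  inst0 t (suc i) = i

  shiftPM : Sort → ℕ → ℕ → MF → MF
  shiftPM s₀ a₀ cut (fm F)     = fm (shiftP s₀ a₀ cut F)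
  shiftPM s₀ a₀ cut (M & N)    = shiftPM s₀ a₀ cut M & shiftPM s₀ a₀ cut N
  shiftPM s₀ a₀ cut (M ⟹ N)   = shiftPM s₀ a₀ cut M ⟹ shiftPM s₀ a₀ cut N
  shiftPM s₀ a₀ cut (∀¹ M)     = ∀¹ (shiftPM s₀ a₀ cut M)
  shiftPM s₀ a₀ cut (∀² s a M) =
    ∀² s a (shiftPM s₀ a₀ (if sameClass s a s₀ a₀ then suc cut else cut) M)

  substPM : (s₀ : Sort) (a₀ j : ℕ) → Fm s₀ → MF → MF
  substPM s₀ a₀ j G (fm F)     = fm (substP s₀ a₀ j G F)
  substPM s₀ a₀ j G (M & N)    = substPM s₀ a₀ j G M & substPM s₀ a₀ j G N
  substPM s₀ a₀ j G (M ⟹ N)   = substPM s₀ a₀ j G M ⟹ substPM s₀ a₀ j G N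
  substPM s₀ a₀ j G (∀¹ M)     = ∀¹ (substPM s₀ a₀ j (ambShift a₀ G) M)
  substPM s₀ a₀ j G (∀² s a M) =
    ∀² s a (substPM s₀ a₀ (if sameClass s a s₀ a₀ then suc j else j) (shiftP s a 0 G) M)

  infix 1 _⊢_
  data _⊢_ : List MF → MF → Set where
    hyp  : ∀ {Γ M} → M ∈ Γ → Γ ⊢ M
    &I   : ∀ {Γ M N} → Γ ⊢ M → Γ ⊢ N → Γ ⊢ M & N
    &E₁  : ∀ {Γ M N} → Γ ⊢ M & N → Γ ⊢ M
    &E₂  : ∀ {Γ M N} → Γ ⊢ M & N → Γ ⊢ N
    ⟹I  : ∀ {Γ M N} → (M ∷ Γ) ⊢ N → Γ ⊢ M ⟹ N
    ⟹E  : ∀ {Γ M N} → Γ ⊢ M ⟹ N → Γ ⊢ M → Γ ⊢ N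
    ∀¹I  : ∀ {Γ M} → map (renM suc) Γ ⊢ M → Γ ⊢ ∀¹ M
    ∀¹E  : ∀ {Γ M} → Γ ⊢ ∀¹ M → (t : ℕ) → Γ ⊢ renM (inst0 t) M
    ∀²I  : ∀ {Γ s a M} → map (shiftPM s a 0) Γ ⊢ M → Γ ⊢ ∀² s a M
    ∀²E  : ∀ {Γ s a M} → Γ ⊢ ∀² s a M → (G : Fm s) → Γ ⊢ substPM s a 0 G M

  AnyFm : Set
  AnyFm = Σ Sort Fm

  data RoP : Set where
    principle : AnyFm → RoP
    rule      : List⁺ AnyFm → AnyFm → RoP

  fvb : ∀ {s} → Fm s → ℕ
  fvb (con c)     = 0
  fvb (pv a k ts) = vfoldr (λ t m → suc t ⊔ m) 0 ts
  fvb (op o F)    = fvb F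
  fvb (F and G)   = fvb F ⊔ fvb G
  fvb (F or G)    = fvb F ⊔ fvb G
  fvb (F imp G)   = fvb F ⊔ fvb G
  fvb (all F)     = pred (fvb F)
  fvb (ex F)      = pred (fvb F)

  occs : ∀ {s} → Fm s → List (Sort × ℕ × ℕ)
  occs (con c)         = []
  occs {s} (pv a k ts) = (s , a , k) ∷ []
  occs (op o F)        = occs F
  occs (F and G)       = occs F ++ occs G
  occs (F or G)        = occs F ++ occs G
  occs (F imp G)       = occs F ++ occs G
  occs (all F)         = occs F
  occs (ex F)          = occs F

  iter : ℕ → (MF → MF) → MF → MF
  iter zero    f M = M
  iter (suc n) f M = f (iter n f M)

  close¹ : AnyFm → MF
  close¹ (s , F) = iter (fvb F) ∀¹ (fm F)

  classOf : Sort × ℕ × ℕ → Sort × ℕ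
  classOf (s , a , k) = s , a

  countIn : Sort × ℕ → List (Sort × ℕ × ℕ) → ℕ
  countIn (s₀ , a₀) = foldr (λ { (s , a , k) m → if sameClass s a s₀ a₀ then suc k ⊔ m else m }) 0

  binders : List AnyFm → List (Sort × ℕ)
  binders Fs =
    let os = concatMap (λ { (s , F) → occs F }) Fs in
    concatMap (λ c → replicate (countIn c os) c) (deduplicate (≡-dec (Lang._≟S_ L) _≟ℕ_) (map classOf os))

  close² : List (Sort × ℕ) → MF → MF
  close² Δ M = foldr (λ { (s , a) N → ∀² s a N }) M Δ

  premisesMF : AnyFm → List AnyFm → MF
  premisesMF F []       = close¹ F
  premisesMF F (G ∷ Gs) = close¹ F & premisesMF G Gs

  toList⁺ : List⁺ AnyFm → List AnyFm
  toList⁺ (F ∷ Fs) = F ∷ Fs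

  toMF : RoP → MF
  toMF (principle F)      = close² (binders (F ∷ [])) (close¹ F)
  toMF (rule (F ∷ Fs) G)  = close² (binders (G ∷ F ∷ Fs)) (premisesMF F Fs ⟹ close¹ G)

  conjD : RoP → List RoP → MF
  conjD R []       = toMF R
  conjD R (S ∷ Rs) = toMF R & conjD S Rs

  Derivable : List⁺ RoP → MF → Set
  Derivable (R ∷ Rs) M = [] ⊢ conjD R Rs ⟹ M

  module Hilbert (s : Sort) (tp bt : Const s) where
    P Q R' : Fm s
    P  = pv 0 0 []
    Q  = pv 0 1 []
    R' = pv 0 2 []
    θ : ℕ → Fm s
    θ x = pv 1 0 (x ∷ [])
    ⊥' : Fm s
    ⊥' = con bt
    ⊤' : Fm s
    ⊤' = con tp

    pr : Fm s → RoP
    pr F = principle (s , F)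

    intuitionistic : List RoP
    intuitionistic =
        pr (P imp (Q imp P))
      ∷ pr ((P imp (Q imp R')) imp ((P imp Q) imp (P imp R')))
      ∷ pr ((P and Q) imp P)
      ∷ pr ((P and Q) imp Q)
      ∷ pr (P imp (Q imp (P and Q)))
      ∷ pr (P imp (P or Q))
      ∷ pr (Q imp (P or Q))
      ∷ pr ((P imp R') imp ((Q imp R') imp ((P or Q) imp R')))
      ∷ pr (⊥' imp P)
      ∷ pr ⊤'
      ∷ pr (all (θ 0) imp θ 0)                                 -- ∀x θ(x) → θ(y)
      ∷ pr (θ 0 imp ex (θ 0))                                  -- θ(y) → ∃x θ(x)
      ∷ pr (all (P imp θ 0) imp (P imp all (θ 0)))
      ∷ pr (all (θ 0 imp P) imp (ex (θ 0) imp P))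
      ∷ rule ((s , P) ∷ (s , (P imp Q)) ∷ []) (s , Q)
      ∷ rule ((s , θ 0) ∷ []) (s , all (θ 0))                  -- θ(x) / ∀x θ(x)
      ∷ []

    classical : List RoP
    classical = intuitionistic ++ (pr (((P imp ⊥') imp ⊥') imp P) ∷ [])

data One : Set where
  ⋆ : One

≟One : DecidableEquality One
≟One ⋆ ⋆ = yes refl

data CConst : One → Set where
  ⊤c ⊥c : CConst ⋆

data NoOp : One → One → Set where

data BoxOp : One → One → Set where
  □ : BoxOp ⋆ ⋆

QCLang : Lang
QCLang = record { Sort = One ; _≟S_ = ≟One ; Const = CConst ; Op = NoOp }

QS4Lang : Lang
QS4Lang = record { Sort = One ; _≟S_ = ≟One ; Const = CConst ; Op = BoxOp }

data HSort : Set where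
  c i : HSort

≟H : DecidableEquality HSort
≟H c c = yes refl
≟H i i = yes refl
≟H c i = no (λ ())
≟H i c = no (λ ())

data HConst : HSort → Set where
  ⊤h ⊥h : HConst c
  ✓h ⋏h : HConst i

data HOp : HSort → HSort → Set where
  `? : HOp i c
  `! : HOp c i

QHCLang : Lang
QHCLang = record { Sort = HSort ; _≟S_ = ≟H ; Const = HConst ; Op = HOp }

module C = Syntax QCLang
module M = Syntax QS4Lang
module H = Syntax QHCLang

D-QC : List⁺ C.RoP
D-QC with C.Hilbert.classical ⋆ ⊤c ⊥c
... | R ∷ Rs = R ∷ Rs
... | []     = C.principle (⋆ , C.con ⊤c) ∷ []   -- unreachable

module S4Ax where
  open M
  p q : Fm ⋆
  p = pv 0 0 []
  q = pv 0 1 []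
  □' : Fm ⋆ → Fm ⋆
  □' F = op □ F
  modal : List RoP
  modal =
      principle (⋆ , (□' p imp p))
    ∷ principle (⋆ , (□' p imp □' (□' p)))
    ∷ principle (⋆ , (□' (p imp q) imp (□' p imp □' q)))
    ∷ rule ((⋆ , p) ∷ []) (⋆ , □' p)
    ∷ []

D-QS4 : List⁺ M.RoP
D-QS4 with M.Hilbert.classical ⋆ ⊤c ⊥c ++ S4Ax.modal
... | R ∷ Rs = R ∷ Rs
... | []     = M.principle (⋆ , M.con ⊤c) ∷ []   -- unreachable

module HCAx where
  open H
  ?' : Fm i → Fm c
  ?' Φ = op `? Φ
  !' : Fm c → Fm i
  !' F = op `! F
  γ δ : Fm i
  γ = pv 0 0 []
  δ = pv 0 1 []
  θ : ℕ → Fm i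
  θ x = pv 1 0 (x ∷ [])
  p q : Fm c
  p = pv 0 0 []
  q = pv 0 1 []
  negc : Fm c → Fm c
  negc F = F imp con ⊥h
  negi : Fm i → Fm i
  negi Φ = Φ imp con ⋏h
  specific : List RoP
  specific =
      principle (c , (?' (γ and δ) iff (?' γ and ?' δ)))
    ∷ principle (c , (?' (γ or δ) iff (?' γ or ?' δ)))
    ∷ principle (c , (?' (γ imp δ) imp (?' γ imp ?' δ)))
    ∷ principle (c , negc (?' (con ⋏h)))
    ∷ principle (c , (?' (ex (θ 0)) iff ex (?' (θ 0))))
    ∷ principle (c , (?' (all (θ 0)) imp all (?' (θ 0))))
    ∷ principle (i , (γ imp !' (?' γ)))
    ∷ principle (i , negi (!' (con ⊥h)))
    ∷ principle (c , (?' (!' p) imp p))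
    ∷ principle (i , (!' p imp !' (?' (!' p))))
    ∷ principle (i , (!' (p imp q) imp (!' p imp !' q)))
    ∷ rule ((i , !' p) ∷ []) (c , p)
    ∷ rule ((c , p) ∷ []) (i , !' p)
    ∷ []

D-QHC : List⁺ H.RoP
D-QHC with H.Hilbert.classical c ⊤h ⊥h ++ H.Hilbert.intuitionistic i ✓h ⋏h ++ HCAx.specific
... | R ∷ Rs = R ∷ Rs
... | []     = H.principle (c , H.con ⊤h) ∷ []   -- unreachable

⊢QC_ : C.RoP → Set
⊢QC R = C.Derivable D-QC (C.toMF R)

⊢QS4_ : M.RoP → Set
⊢QS4 R = M.Derivable D-QS4 (M.toMF R)

⊢QHC_ : H.RoP → Set
⊢QHC R = H.Derivable D-QHC (H.toMF R)

s4toH : ∀ {s} → M.Fm s → H.Fm c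
s4toH (M.con ⊤c)    = H.con ⊤h
s4toH (M.con ⊥c)    = H.con ⊥h
s4toH (M.pv a k ts) = H.pv a k ts
s4toH (M.op □ F)    = H.op `? (H.op `! (s4toH F))
s4toH (F M.and G)   = s4toH F H.and s4toH G
s4toH (F M.or G)    = s4toH F H.or s4toH G
s4toH (F M.imp G)   = s4toH F H.imp s4toH G
s4toH (M.all F)     = H.all (s4toH F)
s4toH (M.ex F)      = H.ex (s4toH F)

qctoH : ∀ {s} → C.Fm s → H.Fm c
qctoH (C.con ⊤c)    = H.con ⊤h
qctoH (C.con ⊥c)    = H.con ⊥h
qctoH (C.pv a k ts) = H.pv a k ts
qctoH (C.op () F)
qctoH (F C.and G)   = qctoH F H.and qctoH G
qctoH (F C.or G)    = qctoH F H.or qctoH G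
qctoH (F C.imp G)   = qctoH F H.imp qctoH G
qctoH (C.all F)     = H.all (qctoH F)
qctoH (C.ex F)      = H.ex (qctoH F)

s4toH-any : M.AnyFm → H.AnyFm
s4toH-any (s , F) = c , s4toH F

qctoH-any : C.AnyFm → H.AnyFm
qctoH-any (s , F) = c , qctoH F

s4toH-RoP : M.RoP → H.RoP
s4toH-RoP (M.principle F)       = H.principle (s4toH-any F)
s4toH-RoP (M.rule (F ∷ Fs) G)   = H.rule (s4toH-any F ∷ map s4toH-any Fs) (s4toH-any G)

qctoH-RoP : C.RoP → H.RoP
qctoH-RoP (C.principle F)       = H.principle (qctoH-any F)
qctoH-RoP (C.rule (F ∷ Fs) G)   = H.rule (qctoH-any F ∷ map qctoH-any Fs) (qctoH-any G)

-- Each inclusion is a syntactic translation of whole meta-derivations: it commutes with the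
-- renamings and substitutions performed by the meta-rules, so it carries derivations to
-- derivations once the translated axioms are derived in the target system.
--
-- Reading □ as ?! sends QS4 into QHC, whose axioms for ? and ! yield the translated S4 axioms.
-- Conversely, erasing ?, reading ! as □ and boxing every i-subformula (the Gödel–McKinsey–Tarski
-- translation, an i-variable α becoming □α) sends QHC into QS4, where every translated QHC axiom
-- is an S4 theorem; on QS4-formulas this undoes the first translation.  Erasing □ likewise sends
-- QS4 into QC, so QS4 is conservative over QC, and QC → QS4 → QHC is the identification of
-- QC-formulas with c-formulas.

module Submission where

open import Defs
open import Data.Bool using (Bool; true; false; if_then_else_; not)
open import Data.Empty using (⊥-elim)
open import Data.Fin using (Fin; toℕ) renaming (zero to fzero; suc to fsuc)
open import Data.List using (List; []; _∷_; map; _++_; concatMap; replicate; deduplicate; filter)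
open import Data.List.Membership.Propositional using (_∈_)
open import Data.List.Membership.Propositional.Properties using (∈-map⁺)
open import Data.List.NonEmpty using (List⁺; _∷_; toList)
open import Data.List.Properties
  using (map-++; map-∘; map-cong; concatMap-cong; concatMap-map; map-concatMap; map-replicate)
open import Data.List.Relation.Binary.Subset.Propositional using (_⊆_)
open import Data.List.Relation.Binary.Subset.Propositional.Properties using (map⁺; ∷⁺ʳ)
open import Data.List.Relation.Unary.Any using (here; there)
open import Data.Nat using (ℕ; zero; suc; pred; _⊔_; _<ᵇ_; _≡ᵇ_; _<_; s≤s; z<s)
open import Data.Nat.Properties using (_<?_; <-cmp; <-irrefl; <-asym; ≮⇒≥) renaming (_≟_ to _≟ℕ_)
open import Data.Product using (∃; _×_; _,_; proj₁; proj₂)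
open import Data.Product.Properties using (≡-dec)
open import Data.Sum using (_⊎_; inj₁; inj₂)
open import Data.Vec using (Vec; []; _∷_; lookup)
open import Data.Vec.Properties using () renaming (map-cong to vmap-cong; map-id to vmap-id)
open import Function using (_∘_; id)
open import Function.Bundles using (_⇔_; mk⇔)
open import Function.Construct.Composition using (_⇔-∘_)
open import Relation.Binary.Definitions using (DecidableEquality; tri<; tri≈; tri>)
open import Relation.Binary.PropositionalEquality
open import Relation.Nullary using (¬_; ¬?; Dec; yes; no; does)
open import Relation.Nullary.Decidable using (dec-true; dec-false)

<ᵇ-true : ∀ {m n} → m < n → (m <ᵇ n) ≡ true
<ᵇ-true {m} {n} = dec-true (m <? n)

<ᵇ-false : ∀ {m n} → ¬ m < n → (m <ᵇ n) ≡ false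
<ᵇ-false {m} {n} = dec-false (m <? n)

≡ᵇ-refl : ∀ n → (n ≡ᵇ n) ≡ true
≡ᵇ-refl n = dec-true (n ≟ℕ n) refl

≡ᵇ-false : ∀ {m n} → m ≢ n → (m ≡ᵇ n) ≡ false
≡ᵇ-false {m} {n} = dec-false (m ≟ℕ n)

shiftIdx : ℕ → ℕ → ℕ
shiftIdx cut k = if k <ᵇ cut then k else suc k

shiftIdx-< : ∀ {cut k} → k < cut → shiftIdx cut k ≡ k
shiftIdx-< k<cut rewrite <ᵇ-true k<cut = refl

shiftIdx-≥ : ∀ {cut k} → ¬ k < cut → shiftIdx cut k ≡ suc k
shiftIdx-≥ k≮cut rewrite <ᵇ-false k≮cut = refl

shiftIdx-suc : ∀ cut k → shiftIdx (suc cut) (suc k) ≡ suc (shiftIdx cut k)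
shiftIdx-suc cut k with k <ᵇ cut
... | true  = refl
... | false = refl

map-filter : ∀ {A B : Set} {P : A → Set} {Q : B → Set}
  (f : A → B) (P? : ∀ x → Dec (P x)) (Q? : ∀ y → Dec (Q y))
  → (∀ x → does (Q? (f x)) ≡ does (P? x)) → ∀ xs → map f (filter P? xs) ≡ filter Q? (map f xs)
map-filter f P? Q? agree [] = refl
map-filter f P? Q? agree (x ∷ xs) with does (P? x) | does (Q? (f x)) | agree x
... | false | false | refl = map-filter f P? Q? agree xs
... | true  | true  | refl = cong (f x ∷_) (map-filter f P? Q? agree xs)

map-deduplicate : ∀ {A B : Set} (f : A → B) (_≟A_ : DecidableEquality A) (_≟B_ : DecidableEquality B)
  → (∀ x y → does (f x ≟B f y) ≡ does (x ≟A y))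
  → ∀ xs → map f (deduplicate _≟A_ xs) ≡ deduplicate _≟B_ (map f xs)
map-deduplicate f _≟A_ _≟B_ agree [] = refl
map-deduplicate f _≟A_ _≟B_ agree (x ∷ xs) = cong (f x ∷_) (begin
  map f (filter (¬? ∘ (x ≟A_)) (deduplicate _≟A_ xs))
    ≡⟨ map-filter f (¬? ∘ (x ≟A_)) (¬? ∘ (f x ≟B_)) (cong not ∘ agree x) (deduplicate _≟A_ xs) ⟩
  filter (¬? ∘ (f x ≟B_)) (map f (deduplicate _≟A_ xs))
    ≡⟨ cong (filter (¬? ∘ (f x ≟B_))) (map-deduplicate f _≟A_ _≟B_ agree xs) ⟩
  filter (¬? ∘ (f x ≟B_)) (deduplicate _≟B_ (map f xs)) ∎)
  where open ≡-Reasoning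

module SyntaxProperties (L : Lang) where
  open Lang L
  open Syntax L
  open ≡-Reasoning

  ≟S-refl : ∀ s → s ≟S s ≡ yes refl
  ≟S-refl s = ≡-≟-identity _≟S_ refl

  sameClass-refl : ∀ s a → sameClass s a s a ≡ true
  sameClass-refl s a rewrite ≟S-refl s = ≡ᵇ-refl a

  sameClass-≢ : ∀ {s a s′ a′} → ¬ (s′ ≡ s × a′ ≡ a) → sameClass s′ a′ s a ≡ false
  sameClass-≢ {s} {a} {s′} {a′} ne with s′ ≟S s
  ... | yes refl = ≡ᵇ-false (λ e → ne (refl , e))
  ... | no _     = refl

  data ClassView (s : Sort) (a : ℕ) : Sort → ℕ → Set where
    same      : ClassView s a s a
    different : ∀ {s′ a′} → ¬ (s′ ≡ s × a′ ≡ a) → ClassView s a s′ a′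

  classView : ∀ s a s′ a′ → ClassView s a s′ a′
  classView s a s′ a′ with s′ ≟S s | a′ ≟ℕ a
  ... | yes refl | yes refl = same
  ... | yes _    | no a≢    = different (a≢ ∘ proj₂)
  ... | no s≢    | _        = different (s≢ ∘ proj₁)

  lift-id : ∀ {ρ} → (∀ x → ρ x ≡ x) → ∀ x → lift ρ x ≡ x
  lift-id ρ≗id zero    = refl
  lift-id ρ≗id (suc x) = cong suc (ρ≗id x)

  ren-id : ∀ {ρ} → (∀ x → ρ x ≡ x) → ∀ {s} (F : Fm s) → ren ρ F ≡ F
  ren-id ρ≗id (con κ)     = refl
  ren-id ρ≗id (pv a k ts) = cong (pv a k) (trans (vmap-cong ρ≗id ts) (vmap-id ts))
  ren-id ρ≗id (op o F)    = cong (op o) (ren-id ρ≗id F)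
  ren-id ρ≗id (F and G)   = cong₂ _and_ (ren-id ρ≗id F) (ren-id ρ≗id G)
  ren-id ρ≗id (F or G)    = cong₂ _or_ (ren-id ρ≗id F) (ren-id ρ≗id G)
  ren-id ρ≗id (F imp G)   = cong₂ _imp_ (ren-id ρ≗id F) (ren-id ρ≗id G)
  ren-id ρ≗id (all F)     = cong all (ren-id (lift-id ρ≗id) F)
  ren-id ρ≗id (ex F)      = cong ex (ren-id (lift-id ρ≗id) F)

  ren-pick-[] : ∀ {s} (F : Fm s) → ren (pick []) F ≡ F
  ren-pick-[] = ren-id (λ _ → refl)

  substP-pv-hit : ∀ {s a j G} ts → substP s a j G (pv {s} a j ts) ≡ ren (pick ts) G
  substP-pv-hit {s} {a} {j} ts
    rewrite ≟S-refl s | ≡-≟-identity _≟ℕ_ {a} refl | <ᵇ-false (<-irrefl {j} refl) | ≡ᵇ-refl j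
    = refl

  substP-pv-< : ∀ {s a j G k} ts → k < j → substP s a j G (pv {s} a k ts) ≡ pv a k ts
  substP-pv-< {s} {a} ts k<j rewrite ≟S-refl s | ≡-≟-identity _≟ℕ_ {a} refl | <ᵇ-true k<j = refl

  substP-pv-> : ∀ {s a j G k} ts → j < k → substP s a j G (pv {s} a k ts) ≡ pv a (pred k) ts
  substP-pv-> {s} {a} ts j<k
    rewrite ≟S-refl s | ≡-≟-identity _≟ℕ_ {a} refl | <ᵇ-false (<-asym j<k)
          | ≡ᵇ-false (λ e → <-irrefl (sym e) j<k) = refl

  substP-pv-≢ : ∀ {s a s′ a′ j G k} ts → ¬ (s′ ≡ s × a′ ≡ a)
    → substP s a j G (pv {s′} a′ k ts) ≡ pv a′ k ts
  substP-pv-≢ {s} {a} {s′} {a′} ts ne with s′ ≟S s | a′ ≟ℕ a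
  ... | yes refl | yes refl = ⊥-elim (ne (refl , refl))
  ... | yes refl | no _     = refl
  ... | no _     | _        = refl

  shiftP-pv : ∀ {s a} cut k ts → shiftP {s} s a cut (pv a k ts) ≡ pv a (shiftIdx cut k) ts
  shiftP-pv {s} {a} cut k ts rewrite sameClass-refl s a with k <ᵇ cut
  ... | true  = refl
  ... | false = refl

  shiftP-pv-≢ : ∀ {s a s′ a′ k} cut ts → ¬ (s′ ≡ s × a′ ≡ a)
    → shiftP {s′} s a cut (pv a′ k ts) ≡ pv a′ k ts
  shiftP-pv-≢ {s} {a} {s′} {a′} cut ts ne rewrite sameClass-≢ {s} {a} {s′} {a′} ne = refl

  substP-shiftP : ∀ s a j (G : Fm s) {t} (F : Fm t) → substP s a j G (shiftP s a j F) ≡ F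
  substP-shiftP s a j G (con κ) = refl
  substP-shiftP s a j G {t} (pv a′ k ts) with classView s a t a′
  ... | different ne = trans (cong (substP s a j G) (shiftP-pv-≢ j ts ne)) (substP-pv-≢ ts ne)
  ... | same = trans (cong (substP s a j G) (shiftP-pv j k ts)) (unshift (k <? j))
    where
    unshift : Dec (k < j) → substP s a j G (pv a (shiftIdx j k) ts) ≡ pv a k ts
    unshift (yes k<j) rewrite shiftIdx-< k<j = substP-pv-< ts k<j
    unshift (no k≮j)  rewrite shiftIdx-≥ k≮j = substP-pv-> ts (s≤s (≮⇒≥ k≮j))
  substP-shiftP s a j G (op o F)  = cong (op o) (substP-shiftP s a j G F)
  substP-shiftP s a j G (F and H) = cong₂ _and_ (substP-shiftP s a j G F) (substP-shiftP s a j G H)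
  substP-shiftP s a j G (F or H)  = cong₂ _or_ (substP-shiftP s a j G F) (substP-shiftP s a j G H)
  substP-shiftP s a j G (F imp H) = cong₂ _imp_ (substP-shiftP s a j G F) (substP-shiftP s a j G H)
  substP-shiftP s a j G (all F)   = cong all (substP-shiftP s a j (ambShift a G) F)
  substP-shiftP s a j G (ex F)    = cong ex (substP-shiftP s a j (ambShift a G) F)

  shiftP-shiftP : ∀ s a cut {t} (F : Fm t)
    → shiftP s a 0 (shiftP s a cut F) ≡ shiftP s a (suc cut) (shiftP s a 0 F)
  shiftP-shiftP s a cut (con κ) = refl
  shiftP-shiftP s a cut {t} (pv a′ k ts) with classView s a t a′
  ... | different ne = begin
    shiftP s a 0 (shiftP s a cut (pv a′ k ts))        ≡⟨ cong (shiftP s a 0) (shiftP-pv-≢ cut ts ne) ⟩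
    shiftP s a 0 (pv a′ k ts)                         ≡⟨ shiftP-pv-≢ 0 ts ne ⟩
    pv a′ k ts                                        ≡⟨ shiftP-pv-≢ (suc cut) ts ne ⟨
    shiftP s a (suc cut) (pv a′ k ts)                 ≡⟨ cong (shiftP s a (suc cut)) (shiftP-pv-≢ 0 ts ne) ⟨
    shiftP s a (suc cut) (shiftP s a 0 (pv a′ k ts))  ∎
  ... | same = begin
    shiftP s a 0 (shiftP s a cut (pv a k ts))         ≡⟨ cong (shiftP s a 0) (shiftP-pv cut k ts) ⟩
    shiftP s a 0 (pv a (shiftIdx cut k) ts)           ≡⟨ shiftP-pv 0 _ ts ⟩
    pv a (suc (shiftIdx cut k)) ts                    ≡⟨ cong (λ n → pv a n ts) (shiftIdx-suc cut k) ⟨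
    pv a (shiftIdx (suc cut) (suc k)) ts              ≡⟨ shiftP-pv (suc cut) (suc k) ts ⟨
    shiftP s a (suc cut) (pv a (suc k) ts)            ≡⟨ cong (shiftP s a (suc cut)) (shiftP-pv 0 k ts) ⟨
    shiftP s a (suc cut) (shiftP s a 0 (pv a k ts))   ∎
  shiftP-shiftP s a cut (op o F)  = cong (op o) (shiftP-shiftP s a cut F)
  shiftP-shiftP s a cut (F and H) = cong₂ _and_ (shiftP-shiftP s a cut F) (shiftP-shiftP s a cut H)
  shiftP-shiftP s a cut (F or H)  = cong₂ _or_ (shiftP-shiftP s a cut F) (shiftP-shiftP s a cut H)
  shiftP-shiftP s a cut (F imp H) = cong₂ _imp_ (shiftP-shiftP s a cut F) (shiftP-shiftP s a cut H)
  shiftP-shiftP s a cut (all F)   = cong all (shiftP-shiftP s a cut F)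
  shiftP-shiftP s a cut (ex F)    = cong ex (shiftP-shiftP s a cut F)

  weaken : ∀ {Γ Δ M} → Γ ⊆ Δ → Γ ⊢ M → Δ ⊢ M
  weaken Γ⊆Δ (hyp M∈Γ) = hyp (Γ⊆Δ M∈Γ)
  weaken Γ⊆Δ (&I d e)  = &I (weaken Γ⊆Δ d) (weaken Γ⊆Δ e)
  weaken Γ⊆Δ (&E₁ d)   = &E₁ (weaken Γ⊆Δ d)
  weaken Γ⊆Δ (&E₂ d)   = &E₂ (weaken Γ⊆Δ d)
  weaken Γ⊆Δ (⟹I d)   = ⟹I (weaken (∷⁺ʳ _ Γ⊆Δ) d)
  weaken Γ⊆Δ (⟹E d e) = ⟹E (weaken Γ⊆Δ d) (weaken Γ⊆Δ e)
  weaken Γ⊆Δ (∀¹I d)   = ∀¹I (weaken (map⁺ (renM suc) Γ⊆Δ) d)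
  weaken Γ⊆Δ (∀¹E d t) = ∀¹E (weaken Γ⊆Δ d) t
  weaken Γ⊆Δ (∀²I {s = s} {a = a} d) = ∀²I (weaken (map⁺ (shiftPM s a 0) Γ⊆Δ) d)
  weaken Γ⊆Δ (∀²E d G) = ∀²E (weaken Γ⊆Δ d) G

  conjunct : MF → ℕ → MF
  conjunct (M & N) zero    = M
  conjunct (M & N) (suc n) = conjunct N n
  conjunct M       _       = M

  ⊢-conjunct : ∀ {Γ M} n → Γ ⊢ M → Γ ⊢ conjunct M n
  ⊢-conjunct {M = M & N} zero    d = &E₁ d
  ⊢-conjunct {M = M & N} (suc n) d = ⊢-conjunct n (&E₂ d)
  ⊢-conjunct {M = fm F}     _ d = d
  ⊢-conjunct {M = M ⟹ N}   _ d = d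
  ⊢-conjunct {M = ∀¹ M}     _ d = d
  ⊢-conjunct {M = ∀² s a M} _ d = d

  ⋀ : List⁺ RoP → MF
  ⋀ (R ∷ Rs) = conjD R Rs

  replaceTail : ℕ → MF → MF → MF
  replaceTail zero    M        N = N
  replaceTail (suc n) (M & M′) N = M & replaceTail n M′ N
  replaceTail (suc n) M        N = N

  ⊢-replaceTail : ∀ {Γ M N} n → Γ ⊢ M → Γ ⊢ N → Γ ⊢ replaceTail n M N
  ⊢-replaceTail             zero    d e = e
  ⊢-replaceTail {M = M & M′} (suc n) d e = &I (&E₁ d) (⊢-replaceTail n (&E₂ d) e)
  ⊢-replaceTail {M = fm F}     (suc n) d e = e
  ⊢-replaceTail {M = M ⟹ M′}  (suc n) d e = e
  ⊢-replaceTail {M = ∀¹ M}     (suc n) d e = e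
  ⊢-replaceTail {M = ∀² s a M} (suc n) d e = e

  infixr 3 _⊗_
  _⊗_ : ∀ {Γ M N} → Γ ⊢ M → Γ ⊢ N → Γ ⊢ M & N
  _⊗_ = &I

  cut : ∀ {D A B} → [] ⊢ A ⟹ B → (D ∷ []) ⊢ A → [] ⊢ D ⟹ B
  cut ⊢A⟹B D⊢A = ⟹I (⟹E (weaken (λ ()) ⊢A⟹B) D⊢A)

module OperatorStrings (L : Lang) where
  open Lang L
  open Syntax L

  infixr 5 _∷_
  data Ops : Sort → Sort → Set where
    []  : ∀ {s} → Ops s s
    _∷_ : ∀ {s t u} → Op t u → Ops s t → Ops s u

  applyOps : ∀ {s t} → Ops s t → Fm s → Fm t
  applyOps []       F = F
  applyOps (o ∷ os) F = op o (applyOps os F)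

  ren-applyOps : ∀ ρ {s t} (os : Ops s t) F → ren ρ (applyOps os F) ≡ applyOps os (ren ρ F)
  ren-applyOps ρ []       F = refl
  ren-applyOps ρ (o ∷ os) F = cong (op o) (ren-applyOps ρ os F)

  shiftP-applyOps : ∀ s₀ a₀ cut {s t} (os : Ops s t) F
    → shiftP s₀ a₀ cut (applyOps os F) ≡ applyOps os (shiftP s₀ a₀ cut F)
  shiftP-applyOps s₀ a₀ cut []       F = refl
  shiftP-applyOps s₀ a₀ cut (o ∷ os) F = cong (op o) (shiftP-applyOps s₀ a₀ cut os F)

  substP-applyOps : ∀ s₀ a₀ j G {s t} (os : Ops s t) F
    → substP s₀ a₀ j G (applyOps os F) ≡ applyOps os (substP s₀ a₀ j G F)
  substP-applyOps s₀ a₀ j G []       F = refl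
  substP-applyOps s₀ a₀ j G (o ∷ os) F = cong (op o) (substP-applyOps s₀ a₀ j G os F)

  fvb-applyOps : ∀ {s t} (os : Ops s t) F → fvb (applyOps os F) ≡ fvb F
  fvb-applyOps []       F = refl
  fvb-applyOps (o ∷ os) F = fvb-applyOps os F

  occs-applyOps : ∀ {s t} (os : Ops s t) F → occs (applyOps os F) ≡ occs F
  occs-applyOps []       F = refl
  occs-applyOps (o ∷ os) F = occs-applyOps os F

-- QCLang and QS4Lang are definitionally OneSorted NoOp and OneSorted BoxOp.
OneSorted : (One → One → Set) → Lang
OneSorted O = record { Sort = One ; _≟S_ = ≟One ; Const = CConst ; Op = O }

module Homomorphism (O : One → One → Set) (L : Lang) (s : Lang.Sort L)
                    (con↦ : CConst ⋆ → Lang.Const L s)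
                    (op↦ : O ⋆ ⋆ → OperatorStrings.Ops L s s) where
  module S  = Syntax (OneSorted O)
  module T  = Syntax L
  module SP = SyntaxProperties (OneSorted O)
  module TP = SyntaxProperties L
  open OperatorStrings L
  open Lang L using (_≟S_)
  open ≡-Reasoning

  tr : S.Fm ⋆ → T.Fm s
  tr (S.con κ)          = T.con (con↦ κ)
  tr (S.pv a k ts)      = T.pv a k ts
  tr (S.op {⋆} {⋆} o F) = applyOps (op↦ o) (tr F)
  tr (F S.and G)        = tr F T.and tr G
  tr (F S.or G)         = tr F T.or tr G
  tr (F S.imp G)        = tr F T.imp tr G
  tr (S.all F)          = T.all (tr F)
  tr (S.ex F)           = T.ex (tr F)

  trMF : S.MF → T.MF
  trMF (S.fm {⋆} F) = T.fm (tr F)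
  trMF (M S.& N)    = trMF M T.& trMF N
  trMF (M S.⟹ N)   = trMF M T.⟹ trMF N
  trMF (S.∀¹ M)     = T.∀¹ (trMF M)
  trMF (S.∀² ⋆ a M) = T.∀² s a (trMF M)

  sameClass-tr : ∀ a′ a → S.sameClass ⋆ a′ ⋆ a ≡ T.sameClass s a′ s a
  sameClass-tr a′ a rewrite TP.≟S-refl s = refl

  tr-ren : ∀ ρ F → tr (S.ren ρ F) ≡ T.ren ρ (tr F)
  tr-ren ρ (S.con κ)          = refl
  tr-ren ρ (S.pv a k ts)      = refl
  tr-ren ρ (S.op {⋆} {⋆} o F) =
    trans (cong (applyOps (op↦ o)) (tr-ren ρ F)) (sym (ren-applyOps ρ (op↦ o) (tr F)))
  tr-ren ρ (F S.and G)        = cong₂ T._and_ (tr-ren ρ F) (tr-ren ρ G)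
  tr-ren ρ (F S.or G)         = cong₂ T._or_ (tr-ren ρ F) (tr-ren ρ G)
  tr-ren ρ (F S.imp G)        = cong₂ T._imp_ (tr-ren ρ F) (tr-ren ρ G)
  tr-ren ρ (S.all F)          = cong T.all (tr-ren (S.lift ρ) F)
  tr-ren ρ (S.ex F)           = cong T.ex (tr-ren (S.lift ρ) F)

  tr-shiftP : ∀ a cut F → tr (S.shiftP ⋆ a cut F) ≡ T.shiftP s a cut (tr F)
  tr-shiftP a cut (S.con κ) = refl
  tr-shiftP a cut (S.pv a′ k ts) with SP.classView ⋆ a ⋆ a′
  ... | SP.same = trans (cong tr (SP.shiftP-pv cut k ts)) (sym (TP.shiftP-pv cut k ts))
  ... | SP.different ne =
        trans (cong tr (SP.shiftP-pv-≢ cut ts ne))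
              (sym (TP.shiftP-pv-≢ cut ts (ne ∘ (refl ,_) ∘ proj₂)))
  tr-shiftP a cut (S.op {⋆} {⋆} o F) =
    trans (cong (applyOps (op↦ o)) (tr-shiftP a cut F)) (sym (shiftP-applyOps s a cut (op↦ o) (tr F)))
  tr-shiftP a cut (F S.and G) = cong₂ T._and_ (tr-shiftP a cut F) (tr-shiftP a cut G)
  tr-shiftP a cut (F S.or G)  = cong₂ T._or_ (tr-shiftP a cut F) (tr-shiftP a cut G)
  tr-shiftP a cut (F S.imp G) = cong₂ T._imp_ (tr-shiftP a cut F) (tr-shiftP a cut G)
  tr-shiftP a cut (S.all F)   = cong T.all (tr-shiftP a cut F)
  tr-shiftP a cut (S.ex F)    = cong T.ex (tr-shiftP a cut F)

  tr-substP-under-binder : ∀ a j G F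
    → tr (S.substP ⋆ a j (S.ambShift a G) F) ≡ T.substP s a j (T.ambShift a (tr G)) (tr F)
  tr-substP : ∀ a j G F → tr (S.substP ⋆ a j G F) ≡ T.substP s a j (tr G) (tr F)
  tr-substP a j G (S.con κ) = refl
  tr-substP a j G (S.pv a′ k ts) with SP.classView ⋆ a ⋆ a′
  ... | SP.different ne =
        trans (cong tr (SP.substP-pv-≢ ts ne)) (sym (TP.substP-pv-≢ ts (ne ∘ (refl ,_) ∘ proj₂)))
  ... | SP.same with <-cmp k j
  ...   | tri< k<j _ _ = trans (cong tr (SP.substP-pv-< ts k<j)) (sym (TP.substP-pv-< ts k<j))
  ...   | tri> _ _ j<k = trans (cong tr (SP.substP-pv-> ts j<k)) (sym (TP.substP-pv-> ts j<k))
  ...   | tri≈ _ refl _ = begin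
    tr (S.substP ⋆ a k G (S.pv a k ts))     ≡⟨ cong tr (SP.substP-pv-hit ts) ⟩
    tr (S.ren (S.pick ts) G)                ≡⟨ tr-ren (S.pick ts) G ⟩
    T.ren (T.pick ts) (tr G)                ≡⟨ TP.substP-pv-hit ts ⟨
    T.substP s a k (tr G) (T.pv a k ts)     ∎
  tr-substP a j G (S.op {⋆} {⋆} o F) =
    trans (cong (applyOps (op↦ o)) (tr-substP a j G F))
          (sym (substP-applyOps s a j (tr G) (op↦ o) (tr F)))
  tr-substP a j G (F S.and H) = cong₂ T._and_ (tr-substP a j G F) (tr-substP a j G H)
  tr-substP a j G (F S.or H)  = cong₂ T._or_ (tr-substP a j G F) (tr-substP a j G H)
  tr-substP a j G (F S.imp H) = cong₂ T._imp_ (tr-substP a j G F) (tr-substP a j G H)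
  tr-substP a j G (S.all F)   = cong T.all (tr-substP-under-binder a j G F)
  tr-substP a j G (S.ex F)    = cong T.ex (tr-substP-under-binder a j G F)

  tr-substP-under-binder a j G F =
    trans (tr-substP a j (S.ambShift a G) F) (cong (λ X → T.substP s a j X (tr F)) (tr-ren _ G))

  trMF-renM : ∀ ρ M → trMF (S.renM ρ M) ≡ T.renM ρ (trMF M)
  trMF-renM ρ (S.fm {⋆} F) = cong T.fm (tr-ren ρ F)
  trMF-renM ρ (M S.& N)    = cong₂ T._&_ (trMF-renM ρ M) (trMF-renM ρ N)
  trMF-renM ρ (M S.⟹ N)   = cong₂ T._⟹_ (trMF-renM ρ M) (trMF-renM ρ N)
  trMF-renM ρ (S.∀¹ M)     = cong T.∀¹ (trMF-renM (S.lift ρ) M)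
  trMF-renM ρ (S.∀² ⋆ a M) = cong (T.∀² s a) (trMF-renM ρ M)

  trMF-shiftPM : ∀ a cut M → trMF (S.shiftPM ⋆ a cut M) ≡ T.shiftPM s a cut (trMF M)
  trMF-shiftPM a cut (S.fm {⋆} F) = cong T.fm (tr-shiftP a cut F)
  trMF-shiftPM a cut (M S.& N)    = cong₂ T._&_ (trMF-shiftPM a cut M) (trMF-shiftPM a cut N)
  trMF-shiftPM a cut (M S.⟹ N)   = cong₂ T._⟹_ (trMF-shiftPM a cut M) (trMF-shiftPM a cut N)
  trMF-shiftPM a cut (S.∀¹ M)     = cong T.∀¹ (trMF-shiftPM a cut M)
  trMF-shiftPM a cut (S.∀² ⋆ a′ M) = cong (T.∀² s a′) (trans (trMF-shiftPM a _ M)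
    (cong (λ b → T.shiftPM s a (if b then suc cut else cut) (trMF M)) (sameClass-tr a′ a)))

  trMF-substPM : ∀ a j G M → trMF (S.substPM ⋆ a j G M) ≡ T.substPM s a j (tr G) (trMF M)
  trMF-substPM a j G (S.fm {⋆} F) = cong T.fm (tr-substP a j G F)
  trMF-substPM a j G (M S.& N)    = cong₂ T._&_ (trMF-substPM a j G M) (trMF-substPM a j G N)
  trMF-substPM a j G (M S.⟹ N)   = cong₂ T._⟹_ (trMF-substPM a j G M) (trMF-substPM a j G N)
  trMF-substPM a j G (S.∀¹ M)     = cong T.∀¹ (trans (trMF-substPM a j (S.ambShift a G) M)
    (cong (λ X → T.substPM s a j X (trMF M)) (tr-ren _ G)))
  trMF-substPM a j G (S.∀² ⋆ a′ M) = cong (T.∀² s a′)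
    (trans (trMF-substPM a _ (S.shiftP ⋆ a′ 0 G) M)
    (cong₂ (λ X b → T.substPM s a (if b then suc j else j) X (trMF M))
           (tr-shiftP a′ 0 G) (sameClass-tr a′ a)))

  map-trMF-renM : ∀ ρ Γ → map trMF (map (S.renM ρ) Γ) ≡ map (T.renM ρ) (map trMF Γ)
  map-trMF-renM ρ []      = refl
  map-trMF-renM ρ (M ∷ Γ) = cong₂ _∷_ (trMF-renM ρ M) (map-trMF-renM ρ Γ)

  map-trMF-shiftPM : ∀ a Γ
    → map trMF (map (S.shiftPM ⋆ a 0) Γ) ≡ map (T.shiftPM s a 0) (map trMF Γ)
  map-trMF-shiftPM a []      = refl
  map-trMF-shiftPM a (M ∷ Γ) = cong₂ _∷_ (trMF-shiftPM a 0 M) (map-trMF-shiftPM a Γ)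

  tr-⊢ : ∀ {Γ M} → Γ S.⊢ M → map trMF Γ T.⊢ trMF M
  tr-⊢ (S.hyp M∈Γ) = T.hyp (∈-map⁺ trMF M∈Γ)
  tr-⊢ (S.&I d e)  = T.&I (tr-⊢ d) (tr-⊢ e)
  tr-⊢ (S.&E₁ d)   = T.&E₁ (tr-⊢ d)
  tr-⊢ (S.&E₂ d)   = T.&E₂ (tr-⊢ d)
  tr-⊢ (S.⟹I d)   = T.⟹I (tr-⊢ d)
  tr-⊢ (S.⟹E d e) = T.⟹E (tr-⊢ d) (tr-⊢ e)
  tr-⊢ {Γ} (S.∀¹I d) = T.∀¹I (subst (T._⊢ _) (map-trMF-renM suc Γ) (tr-⊢ d))
  tr-⊢ (S.∀¹E {M = M} d t) = subst (_ T.⊢_) (sym (trMF-renM (S.inst0 t) M)) (T.∀¹E (tr-⊢ d) t)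
  tr-⊢ {Γ} (S.∀²I {s = ⋆} {a = a} d) = T.∀²I (subst (T._⊢ _) (map-trMF-shiftPM a Γ) (tr-⊢ d))
  tr-⊢ (S.∀²E {s = ⋆} {a = a} {M = M} d G) =
    subst (_ T.⊢_) (sym (trMF-substPM a 0 G M)) (T.∀²E (tr-⊢ d) (tr G))

  trAny : S.AnyFm → T.AnyFm
  trAny (⋆ , F) = s , tr F

  trRoP : S.RoP → T.RoP
  trRoP (S.principle F)     = T.principle (trAny F)
  trRoP (S.rule (F ∷ Fs) G) = T.rule (trAny F ∷ map trAny Fs) (trAny G)

  trClass : One × ℕ → Lang.Sort L × ℕ
  trClass (_ , a) = s , a

  trOcc : One × ℕ × ℕ → Lang.Sort L × ℕ × ℕ
  trOcc (_ , a , k) = s , a , k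

  tr-fvb : ∀ F → T.fvb (tr F) ≡ S.fvb F
  tr-fvb (S.con κ)          = refl
  tr-fvb (S.pv a k ts)      = refl
  tr-fvb (S.op {⋆} {⋆} o F) = trans (fvb-applyOps (op↦ o) (tr F)) (tr-fvb F)
  tr-fvb (F S.and G)        = cong₂ _⊔_ (tr-fvb F) (tr-fvb G)
  tr-fvb (F S.or G)         = cong₂ _⊔_ (tr-fvb F) (tr-fvb G)
  tr-fvb (F S.imp G)        = cong₂ _⊔_ (tr-fvb F) (tr-fvb G)
  tr-fvb (S.all F)          = cong pred (tr-fvb F)
  tr-fvb (S.ex F)           = cong pred (tr-fvb F)

  tr-occs-++ : ∀ F G → T.occs (tr F) ++ T.occs (tr G) ≡ map trOcc (S.occs F ++ S.occs G)
  tr-occs : ∀ F → T.occs (tr F) ≡ map trOcc (S.occs F)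
  tr-occs (S.con κ)          = refl
  tr-occs (S.pv a k ts)      = refl
  tr-occs (S.op {⋆} {⋆} o F) = trans (occs-applyOps (op↦ o) (tr F)) (tr-occs F)
  tr-occs (F S.and G)        = tr-occs-++ F G
  tr-occs (F S.or G)         = tr-occs-++ F G
  tr-occs (F S.imp G)        = tr-occs-++ F G
  tr-occs (S.all F)          = tr-occs F
  tr-occs (S.ex F)           = tr-occs F

  tr-occs-++ F G = trans (cong₂ _++_ (tr-occs F) (tr-occs G)) (sym (map-++ trOcc (S.occs F) (S.occs G)))

  trMF-iter-∀¹ : ∀ n M → trMF (S.iter n S.∀¹ M) ≡ T.iter n T.∀¹ (trMF M)
  trMF-iter-∀¹ zero    M = refl
  trMF-iter-∀¹ (suc n) M = cong T.∀¹ (trMF-iter-∀¹ n M)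

  trMF-close¹ : ∀ F → trMF (S.close¹ F) ≡ T.close¹ (trAny F)
  trMF-close¹ (⋆ , F) =
    trans (trMF-iter-∀¹ (S.fvb F) (S.fm F))
          (cong (λ n → T.iter n T.∀¹ (T.fm (tr F))) (sym (tr-fvb F)))

  trMF-close² : ∀ Δ M → trMF (S.close² Δ M) ≡ T.close² (map trClass Δ) (trMF M)
  trMF-close² []            M = refl
  trMF-close² ((⋆ , a) ∷ Δ) M = cong (T.∀² s a) (trMF-close² Δ M)

  occurrences : List S.AnyFm → List (One × ℕ × ℕ)
  occurrences = concatMap (S.occs ∘ proj₂)

  occurrences-tr : ∀ Fs → concatMap (T.occs ∘ proj₂) (map trAny Fs) ≡ map trOcc (occurrences Fs)
  occurrences-tr []             = refl
  occurrences-tr ((⋆ , F) ∷ Fs) =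
    trans (cong₂ _++_ (tr-occs F) (occurrences-tr Fs)) (sym (map-++ trOcc (S.occs F) (occurrences Fs)))

  countIn-tr : ∀ a os → T.countIn (s , a) (map trOcc os) ≡ S.countIn (⋆ , a) os
  countIn-tr a []                  = refl
  countIn-tr a ((⋆ , a′ , k) ∷ os) rewrite sym (sameClass-tr a′ a) | countIn-tr a os = refl

  trClass-≟ : ∀ x y
    → does (≡-dec _≟S_ _≟ℕ_ (trClass x) (trClass y)) ≡ does (≡-dec ≟One _≟ℕ_ x y)
  trClass-≟ (⋆ , a) (⋆ , b) rewrite TP.≟S-refl s with a ≟ℕ b
  ... | yes refl = refl
  ... | no _     = refl

  -- trClass is injective, so it commutes with the deduplication inside binders.
  tr-binders : ∀ Fs → T.binders (map trAny Fs) ≡ map trClass (S.binders Fs)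
  tr-binders Fs = begin
    concatMap (repeatT osT) (dedupT (map T.classOf osT))
      ≡⟨ cong (λ os → concatMap (repeatT os) (dedupT (map T.classOf os))) (occurrences-tr Fs) ⟩
    concatMap (repeatT (map trOcc osS)) (dedupT (map T.classOf (map trOcc osS)))
      ≡⟨ cong (concatMap (repeatT (map trOcc osS)) ∘ dedupT) (trans (sym (map-∘ osS)) (map-∘ osS)) ⟩
    concatMap (repeatT (map trOcc osS)) (dedupT (map trClass (map S.classOf osS)))
      ≡⟨ cong (concatMap (repeatT (map trOcc osS)))
              (map-deduplicate trClass _ _ trClass-≟ (map S.classOf osS)) ⟨
    concatMap (repeatT (map trOcc osS)) (map trClass (dedupS (map S.classOf osS)))
      ≡⟨ concatMap-map (repeatT (map trOcc osS)) trClass (dedupS (map S.classOf osS)) ⟩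
    concatMap (repeatT (map trOcc osS) ∘ trClass) (dedupS (map S.classOf osS))
      ≡⟨ concatMap-cong repeat-tr (dedupS (map S.classOf osS)) ⟩
    concatMap (map trClass ∘ repeatS osS) (dedupS (map S.classOf osS))
      ≡⟨ map-concatMap trClass (repeatS osS) (dedupS (map S.classOf osS)) ⟨
    map trClass (S.binders Fs) ∎
    where
    osS = occurrences Fs
    osT = concatMap (T.occs ∘ proj₂) (map trAny Fs)
    dedupS = deduplicate (≡-dec ≟One _≟ℕ_)
    dedupT = deduplicate (≡-dec _≟S_ _≟ℕ_)
    repeatS : List (One × ℕ × ℕ) → One × ℕ → List (One × ℕ)
    repeatS os cl = replicate (S.countIn cl os) cl
    repeatT : List (Lang.Sort L × ℕ × ℕ) → Lang.Sort L × ℕ → List (Lang.Sort L × ℕ)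
    repeatT os cl = replicate (T.countIn cl os) cl
    repeat-tr : ∀ cl → repeatT (map trOcc osS) (trClass cl) ≡ map trClass (repeatS osS cl)
    repeat-tr (⋆ , a) = trans (cong (λ n → replicate n (s , a)) (countIn-tr a osS))
                              (sym (map-replicate trClass (S.countIn (⋆ , a) osS) (⋆ , a)))

  trMF-premisesMF : ∀ F Fs → trMF (S.premisesMF F Fs) ≡ T.premisesMF (trAny F) (map trAny Fs)
  trMF-premisesMF F []       = trMF-close¹ F
  trMF-premisesMF F (G ∷ Gs) = cong₂ T._&_ (trMF-close¹ F) (trMF-premisesMF G Gs)

  trMF-toMF : ∀ R → trMF (S.toMF R) ≡ T.toMF (trRoP R)
  trMF-toMF (S.principle F) = trans (trMF-close² (S.binders (F ∷ [])) (S.close¹ F))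
    (cong₂ T.close² (sym (tr-binders (F ∷ []))) (trMF-close¹ F))
  trMF-toMF (S.rule (F ∷ Fs) G) = trans (trMF-close² (S.binders (G ∷ F ∷ Fs)) _)
    (cong₂ T.close² (sym (tr-binders (G ∷ F ∷ Fs)))
                    (cong₂ T._⟹_ (trMF-premisesMF F Fs) (trMF-close¹ G)))

  tr-derivable : ∀ D D′ → (TP.⋀ D′ ∷ []) T.⊢ trMF (SP.⋀ D)
    → ∀ R → S.Derivable D (S.toMF R) → T.Derivable D′ (T.toMF (trRoP R))
  tr-derivable (R₀ ∷ Rs) (R₀′ ∷ Rs′) D′⊢D R d =
    TP.cut (subst (λ X → [] T.⊢ trMF (S.conjD R₀ Rs) T.⟹ X) (trMF-toMF R) (tr-⊢ d)) D′⊢D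

module Schemata (L : Lang) (s : Lang.Sort L) where
  open Lang L
  open Syntax L
  open SyntaxProperties L
  open ≡-Reasoning

  infixr 6 _∧ˢ_
  infixr 5 _∨ˢ_
  infixr 4 _⇒ˢ_
  data Schema (n : ℕ) : Sort → Set where
    var  : Fin n → Schema n s
    conˢ : ∀ {t} → Const t → Schema n t
    opˢ  : ∀ {t u} → Op t u → Schema n t → Schema n u
    _∧ˢ_ _∨ˢ_ _⇒ˢ_ : ∀ {t} → Schema n t → Schema n t → Schema n t

  v₀ : ∀ {n} → Schema (suc n) s
  v₀ = var fzero
  v₁ : ∀ {n} → Schema (suc (suc n)) s
  v₁ = var (fsuc fzero)
  v₂ : ∀ {n} → Schema (suc (suc (suc n))) s
  v₂ = var (fsuc (fsuc fzero))

  ⌜_⌝ : ∀ {n t} → Schema n t → Fm t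
  ⌜ var x ⌝    = pv 0 (toℕ x) []
  ⌜ conˢ κ ⌝   = con κ
  ⌜ opˢ o p ⌝  = op o ⌜ p ⌝
  ⌜ p ∧ˢ q ⌝   = ⌜ p ⌝ and ⌜ q ⌝
  ⌜ p ∨ˢ q ⌝   = ⌜ p ⌝ or ⌜ q ⌝
  ⌜ p ⇒ˢ q ⌝   = ⌜ p ⌝ imp ⌜ q ⌝

  _⟦_⟧ : ∀ {n t} → Schema n t → Vec (Fm s) n → Fm t
  var x ⟦ σ ⟧    = lookup σ x
  conˢ κ ⟦ σ ⟧   = con κ
  opˢ o p ⟦ σ ⟧  = op o (p ⟦ σ ⟧)
  (p ∧ˢ q) ⟦ σ ⟧ = p ⟦ σ ⟧ and q ⟦ σ ⟧
  (p ∨ˢ q) ⟦ σ ⟧ = p ⟦ σ ⟧ or q ⟦ σ ⟧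
  (p ⇒ˢ q) ⟦ σ ⟧ = p ⟦ σ ⟧ imp q ⟦ σ ⟧

  ↑ : ∀ {t} → Fm t → Fm t
  ↑ = shiftP s 0 0

  substP-⌜⌝₁ : ∀ A {t} (p : Schema 1 t) → substP s 0 0 A ⌜ p ⌝ ≡ p ⟦ A ∷ [] ⟧
  substP-⌜⌝₁ A (var fzero) = trans (substP-pv-hit []) (ren-pick-[] A)
  substP-⌜⌝₁ A (conˢ κ)    = refl
  substP-⌜⌝₁ A (opˢ o p)   = cong (op o) (substP-⌜⌝₁ A p)
  substP-⌜⌝₁ A (p ∧ˢ q)    = cong₂ _and_ (substP-⌜⌝₁ A p) (substP-⌜⌝₁ A q)
  substP-⌜⌝₁ A (p ∨ˢ q)    = cong₂ _or_ (substP-⌜⌝₁ A p) (substP-⌜⌝₁ A q)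
  substP-⌜⌝₁ A (p ⇒ˢ q)    = cong₂ _imp_ (substP-⌜⌝₁ A p) (substP-⌜⌝₁ A q)

  substP-⌜⌝₂ : ∀ A B {t} (p : Schema 2 t)
    → substP s 0 0 A (substP s 0 1 (↑ B) ⌜ p ⌝) ≡ p ⟦ A ∷ B ∷ [] ⟧
  substP-⌜⌝₂ A B (var fzero) =
    trans (cong (substP s 0 0 A) (substP-pv-< [] z<s)) (trans (substP-pv-hit []) (ren-pick-[] A))
  substP-⌜⌝₂ A B (var (fsuc fzero)) =
    trans (cong (substP s 0 0 A) (trans (substP-pv-hit []) (ren-pick-[] (↑ B))))
          (substP-shiftP s 0 0 A B)
  substP-⌜⌝₂ A B (conˢ κ)  = refl
  substP-⌜⌝₂ A B (opˢ o p) = cong (op o) (substP-⌜⌝₂ A B p)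
  substP-⌜⌝₂ A B (p ∧ˢ q)  = cong₂ _and_ (substP-⌜⌝₂ A B p) (substP-⌜⌝₂ A B q)
  substP-⌜⌝₂ A B (p ∨ˢ q)  = cong₂ _or_ (substP-⌜⌝₂ A B p) (substP-⌜⌝₂ A B q)
  substP-⌜⌝₂ A B (p ⇒ˢ q)  = cong₂ _imp_ (substP-⌜⌝₂ A B p) (substP-⌜⌝₂ A B q)

  substP-⌜⌝₃ : ∀ A B C {t} (p : Schema 3 t)
    → substP s 0 0 A (substP s 0 1 (↑ B) (substP s 0 2 (↑ (↑ C)) ⌜ p ⌝)) ≡ p ⟦ A ∷ B ∷ C ∷ [] ⟧
  substP-⌜⌝₃ A B C (var fzero) = begin
    substP s 0 0 A (substP s 0 1 (↑ B) (substP s 0 2 (↑ (↑ C)) (pv 0 0 [])))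
      ≡⟨ cong (substP s 0 0 A ∘ substP s 0 1 (↑ B)) (substP-pv-< [] z<s) ⟩
    substP s 0 0 A (substP s 0 1 (↑ B) (pv 0 0 []))
      ≡⟨ cong (substP s 0 0 A) (substP-pv-< [] z<s) ⟩
    substP s 0 0 A (pv 0 0 [])
      ≡⟨ trans (substP-pv-hit []) (ren-pick-[] A) ⟩
    A ∎
  substP-⌜⌝₃ A B C (var (fsuc fzero)) = begin
    substP s 0 0 A (substP s 0 1 (↑ B) (substP s 0 2 (↑ (↑ C)) (pv 0 1 [])))
      ≡⟨ cong (substP s 0 0 A ∘ substP s 0 1 (↑ B)) (substP-pv-< [] (s≤s z<s)) ⟩
    substP s 0 0 A (substP s 0 1 (↑ B) (pv 0 1 []))
      ≡⟨ cong (substP s 0 0 A) (trans (substP-pv-hit []) (ren-pick-[] (↑ B))) ⟩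
    substP s 0 0 A (↑ B)
      ≡⟨ substP-shiftP s 0 0 A B ⟩
    B ∎
  substP-⌜⌝₃ A B C (var (fsuc (fsuc fzero))) = begin
    substP s 0 0 A (substP s 0 1 (↑ B) (substP s 0 2 (↑ (↑ C)) (pv 0 2 [])))
      ≡⟨ cong (substP s 0 0 A ∘ substP s 0 1 (↑ B))
              (trans (substP-pv-hit []) (ren-pick-[] (↑ (↑ C)))) ⟩
    substP s 0 0 A (substP s 0 1 (↑ B) (↑ (↑ C)))
      ≡⟨ cong (substP s 0 0 A ∘ substP s 0 1 (↑ B)) (shiftP-shiftP s 0 0 C) ⟩
    substP s 0 0 A (substP s 0 1 (↑ B) (shiftP s 0 1 (↑ C)))
      ≡⟨ cong (substP s 0 0 A) (substP-shiftP s 0 1 (↑ B) (↑ C)) ⟩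
    substP s 0 0 A (↑ C)
      ≡⟨ substP-shiftP s 0 0 A C ⟩
    C ∎
  substP-⌜⌝₃ A B C (conˢ κ)  = refl
  substP-⌜⌝₃ A B C (opˢ o p) = cong (op o) (substP-⌜⌝₃ A B C p)
  substP-⌜⌝₃ A B C (p ∧ˢ q)  = cong₂ _and_ (substP-⌜⌝₃ A B C p) (substP-⌜⌝₃ A B C q)
  substP-⌜⌝₃ A B C (p ∨ˢ q)  = cong₂ _or_ (substP-⌜⌝₃ A B C p) (substP-⌜⌝₃ A B C q)
  substP-⌜⌝₃ A B C (p ⇒ˢ q)  = cong₂ _imp_ (substP-⌜⌝₃ A B C p) (substP-⌜⌝₃ A B C q)

  infix 1 _⊢∀₁_ _⊢∀₂_ _⊢∀₃_
  _⊢∀₁_ : ∀ {t} → List MF → Schema 1 t → Set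
  Γ ⊢∀₁ p = Γ ⊢ ∀² s 0 (fm ⌜ p ⌝)
  _⊢∀₂_ : ∀ {t} → List MF → Schema 2 t → Set
  Γ ⊢∀₂ p = Γ ⊢ ∀² s 0 (∀² s 0 (fm ⌜ p ⌝))
  _⊢∀₃_ : ∀ {t} → List MF → Schema 3 t → Set
  Γ ⊢∀₃ p = Γ ⊢ ∀² s 0 (∀² s 0 (∀² s 0 (fm ⌜ p ⌝)))

  Rule₁ : ∀ {t u} → List MF → Schema 1 t → Schema 1 u → Set
  Rule₁ Γ p q = Γ ⊢ ∀² s 0 (fm ⌜ p ⌝ ⟹ fm ⌜ q ⌝)
  Rule₂ : ∀ {t} → List MF → Schema 2 t → Schema 2 t → Schema 2 t → Set
  Rule₂ Γ p q r = Γ ⊢ ∀² s 0 (∀² s 0 (fm ⌜ p ⌝ & fm ⌜ q ⌝ ⟹ fm ⌜ r ⌝))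

  module _ {Γ : List MF} where

    ∀²E₂ : ∀ {M} → Γ ⊢ ∀² s 0 (∀² s 0 M)
      → ∀ A B → Γ ⊢ substPM s 0 0 A (substPM s 0 1 (↑ B) M)
    ∀²E₂ {M} d A B = subst P (sameClass-refl s 0) (∀²E (∀²E d B) A)
      where
      P : Bool → Set
      P b = Γ ⊢ substPM s 0 0 A (substPM s 0 (if b then 1 else 0) (↑ B) M)

    ∀²E₃ : ∀ {M} → Γ ⊢ ∀² s 0 (∀² s 0 (∀² s 0 M)) → ∀ A B C
      → Γ ⊢ substPM s 0 0 A (substPM s 0 1 (↑ B) (substPM s 0 2 (↑ (↑ C)) M))
    ∀²E₃ {M} d A B C = subst P (sameClass-refl s 0) (∀²E (∀²E (∀²E d C) B) A)
      where
      P : Bool → Set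
      P b = let j = if b then 1 else 0 in
            Γ ⊢ substPM s 0 0 A (substPM s 0 j (↑ B)
                  (substPM s 0 (if b then suc j else j) (↑ (↑ C)) M))

    fm-cast : ∀ {t} {X Y : Fm t} → X ≡ Y → Γ ⊢ fm X → Γ ⊢ fm Y
    fm-cast = subst (λ X → Γ ⊢ fm X)

    instantiate₁ : ∀ {t} (p : Schema 1 t) → Γ ⊢∀₁ p → ∀ A → Γ ⊢ fm (p ⟦ A ∷ [] ⟧)
    instantiate₁ p d A = fm-cast (substP-⌜⌝₁ A p) (∀²E d A)

    instantiate₂ : ∀ {t} (p : Schema 2 t) → Γ ⊢∀₂ p → ∀ A B → Γ ⊢ fm (p ⟦ A ∷ B ∷ [] ⟧)
    instantiate₂ p d A B = fm-cast (substP-⌜⌝₂ A B p) (∀²E₂ d A B)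

    instantiate₃ : ∀ {t} (p : Schema 3 t) → Γ ⊢∀₃ p → ∀ A B C → Γ ⊢ fm (p ⟦ A ∷ B ∷ C ∷ [] ⟧)
    instantiate₃ p d A B C = fm-cast (substP-⌜⌝₃ A B C p) (∀²E₃ d A B C)

    instantiateRule₁ : ∀ {t u} (p : Schema 1 t) (q : Schema 1 u) → Rule₁ Γ p q
      → ∀ A → Γ ⊢ fm (p ⟦ A ∷ [] ⟧) → Γ ⊢ fm (q ⟦ A ∷ [] ⟧)
    instantiateRule₁ p q d A ⊢p =
      fm-cast (substP-⌜⌝₁ A q) (⟹E (∀²E d A) (fm-cast (sym (substP-⌜⌝₁ A p)) ⊢p))

    instantiateRule₂ : ∀ {t} (p q r : Schema 2 t) → Rule₂ Γ p q r → ∀ A B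
      → Γ ⊢ fm (p ⟦ A ∷ B ∷ [] ⟧) → Γ ⊢ fm (q ⟦ A ∷ B ∷ [] ⟧) → Γ ⊢ fm (r ⟦ A ∷ B ∷ [] ⟧)
    instantiateRule₂ p q r d A B ⊢p ⊢q =
      fm-cast (substP-⌜⌝₂ A B r)
        (⟹E (∀²E₂ d A B) (&I (fm-cast (sym (substP-⌜⌝₂ A B p)) ⊢p)
                              (fm-cast (sym (substP-⌜⌝₂ A B q)) ⊢q)))

module HilbertReasoning (L : Lang) (s : Lang.Sort L) (tp bt : Lang.Const L s) where
  open Syntax L
  open Schemata L s

  record HilbertAxioms (Γ : List MF) : Set where
    field
      mp   : Rule₂ Γ v₀ (v₀ ⇒ˢ v₁) v₁
      K    : Γ ⊢∀₂ v₀ ⇒ˢ v₁ ⇒ˢ v₀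
      S    : Γ ⊢∀₃ (v₀ ⇒ˢ v₁ ⇒ˢ v₂) ⇒ˢ (v₀ ⇒ˢ v₁) ⇒ˢ v₀ ⇒ˢ v₂
      ∧-E₁ : Γ ⊢∀₂ v₀ ∧ˢ v₁ ⇒ˢ v₀
      ∧-E₂ : Γ ⊢∀₂ v₀ ∧ˢ v₁ ⇒ˢ v₁
      ∧-I  : Γ ⊢∀₂ v₀ ⇒ˢ v₁ ⇒ˢ v₀ ∧ˢ v₁
      ∨-I₁ : Γ ⊢∀₂ v₀ ⇒ˢ v₀ ∨ˢ v₁
      ∨-I₂ : Γ ⊢∀₂ v₁ ⇒ˢ v₀ ∨ˢ v₁
      ∨-E  : Γ ⊢∀₃ (v₀ ⇒ˢ v₂) ⇒ˢ (v₁ ⇒ˢ v₂) ⇒ˢ v₀ ∨ˢ v₁ ⇒ˢ v₂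
      ⊥-E  : Γ ⊢∀₁ conˢ bt ⇒ˢ v₀
      ⊤-I  : Γ ⊢ fm (con tp)

  module Reasoning {Γ : List MF} (ax : HilbertAxioms Γ) where
    open HilbertAxioms ax

    modusPonens : ∀ {A B} → Γ ⊢ fm A → Γ ⊢ fm (A imp B) → Γ ⊢ fm B
    modusPonens {A} {B} = instantiateRule₂ v₀ (v₀ ⇒ˢ v₁) v₁ mp A B

    axK : ∀ A B → Γ ⊢ fm (A imp B imp A)
    axK = instantiate₂ _ K

    axS : ∀ A B C → Γ ⊢ fm ((A imp B imp C) imp (A imp B) imp A imp C)
    axS = instantiate₃ _ S

    ⇒-refl : ∀ A → Γ ⊢ fm (A imp A)
    ⇒-refl A = modusPonens (axK A A) (modusPonens (axK A (A imp A)) (axS A (A imp A) A))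

    infix  1 _⊢ʰ_
    infixl 5 _·_
    data _⊢ʰ_ (Δ : List (Fm s)) : Fm s → Set where
      assume  : ∀ {A} → A ∈ Δ → Δ ⊢ʰ A
      theorem : ∀ {A} → Γ ⊢ fm A → Δ ⊢ʰ A
      _·_     : ∀ {A B} → Δ ⊢ʰ A imp B → Δ ⊢ʰ A → Δ ⊢ʰ B

    deduction : ∀ {Δ A B} → A ∷ Δ ⊢ʰ B → Δ ⊢ʰ A imp B
    deduction {A = A} (assume (here refl))     = theorem (⇒-refl A)
    deduction {A = A} (assume {B} (there B∈Δ)) = theorem (axK B A) · assume B∈Δ
    deduction {A = A} (theorem {B} d)          = theorem (axK B A) · theorem d
    deduction {A = A} (_·_ {C} {B} p q)        = theorem (axS A C B) · deduction p · deduction q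

    discharge : ∀ {A} → [] ⊢ʰ A → Γ ⊢ fm A
    discharge (assume ())
    discharge (theorem d) = d
    discharge (p · q)     = modusPonens (discharge q) (discharge p)

    #0 : ∀ {Δ A} → A ∷ Δ ⊢ʰ A
    #0 = assume (here refl)
    #1 : ∀ {Δ A B} → B ∷ A ∷ Δ ⊢ʰ A
    #1 = assume (there (here refl))
    #2 : ∀ {Δ A B C} → C ∷ B ∷ A ∷ Δ ⊢ʰ A
    #2 = assume (there (there (here refl)))
    #3 : ∀ {Δ A B C D} → D ∷ C ∷ B ∷ A ∷ Δ ⊢ʰ A
    #3 = assume (there (there (there (here refl))))

    ∧I : ∀ {Δ A B} → Δ ⊢ʰ A → Δ ⊢ʰ B → Δ ⊢ʰ A and B
    ∧I {A = A} {B} p q = theorem (instantiate₂ _ ∧-I A B) · p · q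
    ∧E₁ : ∀ {Δ A B} → Δ ⊢ʰ A and B → Δ ⊢ʰ A
    ∧E₁ {A = A} {B} p = theorem (instantiate₂ _ ∧-E₁ A B) · p
    ∧E₂ : ∀ {Δ A B} → Δ ⊢ʰ A and B → Δ ⊢ʰ B
    ∧E₂ {A = A} {B} p = theorem (instantiate₂ _ ∧-E₂ A B) · p
    ∨I₁ : ∀ {Δ A B} → Δ ⊢ʰ A → Δ ⊢ʰ A or B
    ∨I₁ {A = A} {B} p = theorem (instantiate₂ _ ∨-I₁ A B) · p
    ∨I₂ : ∀ {Δ A B} → Δ ⊢ʰ B → Δ ⊢ʰ A or B
    ∨I₂ {A = A} {B} p = theorem (instantiate₂ _ ∨-I₂ A B) · p
    ∨E : ∀ {Δ A B C} → Δ ⊢ʰ A or B → A ∷ Δ ⊢ʰ C → B ∷ Δ ⊢ʰ C → Δ ⊢ʰ C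
    ∨E {A = A} {B} {C} d p q = theorem (instantiate₃ _ ∨-E A B C) · deduction p · deduction q · d
    ⊥E : ∀ {Δ A} → Δ ⊢ʰ con bt → Δ ⊢ʰ A
    ⊥E {A = A} p = theorem (instantiate₁ _ ⊥-E A) · p
    ⊤I : ∀ {Δ} → Δ ⊢ʰ con tp
    ⊤I = theorem ⊤-I
    ⇔I : ∀ {Δ A B} → A ∷ Δ ⊢ʰ B → B ∷ Δ ⊢ʰ A → Δ ⊢ʰ A iff B
    ⇔I p q = ∧I (deduction p) (deduction q)

    ⇒-trans : ∀ {A B C} → Γ ⊢ fm (A imp B) → Γ ⊢ fm (B imp C) → Γ ⊢ fm (A imp C)
    ⇒-trans A⇒B B⇒C = discharge (deduction (theorem B⇒C · (theorem A⇒B · #0)))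

module OneSortedHilbert (O : One → One → Set) where
  open Syntax (OneSorted O)
  open SyntaxProperties (OneSorted O)
  open HilbertReasoning (OneSorted O) ⋆ ⊤c ⊥c
  open Hilbert ⋆ ⊤c ⊥c using (intuitionistic)

  ExtendsIntuitionistic : List⁺ RoP → Set
  ExtendsIntuitionistic D = ∃ λ Rs → toList D ≡ intuitionistic ++ Rs

  hilbertAxioms : ∀ {Γ} D → ExtendsIntuitionistic D → Γ ⊢ ⋀ D → HilbertAxioms Γ
  hilbertAxioms (R ∷ Rs) (_ , refl) d = record
    { mp = ⊢-conjunct 14 d ; K = ⊢-conjunct 0 d ; S = ⊢-conjunct 1 d
    ; ∧-E₁ = ⊢-conjunct 2 d ; ∧-E₂ = ⊢-conjunct 3 d ; ∧-I = ⊢-conjunct 4 d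
    ; ∨-I₁ = ⊢-conjunct 5 d ; ∨-I₂ = ⊢-conjunct 6 d ; ∨-E = ⊢-conjunct 7 d
    ; ⊥-E = ⊢-conjunct 8 d ; ⊤-I = ⊢-conjunct 9 d
    }

module CP = SyntaxProperties QCLang
module HP = SyntaxProperties QHCLang
module MP = SyntaxProperties QS4Lang

open OperatorStrings using (Ops; []; _∷_)

⊤⊥↦ᴴ : CConst ⋆ → HConst c
⊤⊥↦ᴴ ⊤c = ⊤h
⊤⊥↦ᴴ ⊥c = ⊥h

□↦?! : BoxOp ⋆ ⋆ → Ops QHCLang c c
□↦?! □ = `? ∷ `! ∷ []

□↦ε : BoxOp ⋆ ⋆ → Ops QCLang ⋆ ⋆
□↦ε □ = []

noOp↦ : NoOp ⋆ ⋆ → Ops QS4Lang ⋆ ⋆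
noOp↦ ()

module QS4inQHC = Homomorphism BoxOp QHCLang c ⊤⊥↦ᴴ □↦?!
module QCinQS4  = Homomorphism NoOp QS4Lang ⋆ id noOp↦
module EraseBox = Homomorphism BoxOp QCLang ⋆ id □↦ε

QS4inQHC-tr : ∀ F → QS4inQHC.tr F ≡ s4toH F
QS4inQHC-tr (M.con ⊤c)    = refl
QS4inQHC-tr (M.con ⊥c)    = refl
QS4inQHC-tr (M.pv a k ts) = refl
QS4inQHC-tr (M.op □ F)    = cong (H.op `? ∘ H.op `!) (QS4inQHC-tr F)
QS4inQHC-tr (F M.and G)   = cong₂ H._and_ (QS4inQHC-tr F) (QS4inQHC-tr G)
QS4inQHC-tr (F M.or G)    = cong₂ H._or_ (QS4inQHC-tr F) (QS4inQHC-tr G)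
QS4inQHC-tr (F M.imp G)   = cong₂ H._imp_ (QS4inQHC-tr F) (QS4inQHC-tr G)
QS4inQHC-tr (M.all F)     = cong H.all (QS4inQHC-tr F)
QS4inQHC-tr (M.ex F)      = cong H.ex (QS4inQHC-tr F)

QS4inQHC-trRoP : ∀ R → QS4inQHC.trRoP R ≡ s4toH-RoP R
QS4inQHC-trRoP (M.principle (⋆ , F))     = cong (H.principle ∘ (c ,_)) (QS4inQHC-tr F)
QS4inQHC-trRoP (M.rule (F ∷ Fs) (⋆ , G)) =
  cong₂ H.rule (cong₂ _∷_ (any-eq F) (map-cong any-eq Fs)) (cong (c ,_) (QS4inQHC-tr G))
  where
  any-eq : ∀ F → QS4inQHC.trAny F ≡ s4toH-any F
  any-eq (⋆ , F) = cong (c ,_) (QS4inQHC-tr F)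

s4toH-QCinQS4 : ∀ F → s4toH (QCinQS4.tr F) ≡ qctoH F
s4toH-QCinQS4 (C.con ⊤c)    = refl
s4toH-QCinQS4 (C.con ⊥c)    = refl
s4toH-QCinQS4 (C.pv a k ts) = refl
s4toH-QCinQS4 (C.op () F)
s4toH-QCinQS4 (F C.and G)   = cong₂ H._and_ (s4toH-QCinQS4 F) (s4toH-QCinQS4 G)
s4toH-QCinQS4 (F C.or G)    = cong₂ H._or_ (s4toH-QCinQS4 F) (s4toH-QCinQS4 G)
s4toH-QCinQS4 (F C.imp G)   = cong₂ H._imp_ (s4toH-QCinQS4 F) (s4toH-QCinQS4 G)
s4toH-QCinQS4 (C.all F)     = cong H.all (s4toH-QCinQS4 F)
s4toH-QCinQS4 (C.ex F)      = cong H.ex (s4toH-QCinQS4 F)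

s4toH-RoP-QCinQS4 : ∀ R → s4toH-RoP (QCinQS4.trRoP R) ≡ qctoH-RoP R
s4toH-RoP-QCinQS4 (C.principle (⋆ , F))     = cong (H.principle ∘ (c ,_)) (s4toH-QCinQS4 F)
s4toH-RoP-QCinQS4 (C.rule (F ∷ Fs) (⋆ , G)) =
  cong₂ H.rule (cong₂ _∷_ (any-eq F) (trans (sym (map-∘ Fs)) (map-cong any-eq Fs)))
               (cong (c ,_) (s4toH-QCinQS4 G))
  where
  any-eq : ∀ F → s4toH-any (QCinQS4.trAny F) ≡ qctoH-any F
  any-eq (⋆ , F) = cong (c ,_) (s4toH-QCinQS4 F)

EraseBox-QCinQS4 : ∀ F → EraseBox.tr (QCinQS4.tr F) ≡ F
EraseBox-QCinQS4 (C.con ⊤c)    = refl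
EraseBox-QCinQS4 (C.con ⊥c)    = refl
EraseBox-QCinQS4 (C.pv a k ts) = refl
EraseBox-QCinQS4 (C.op () F)
EraseBox-QCinQS4 (F C.and G)   = cong₂ C._and_ (EraseBox-QCinQS4 F) (EraseBox-QCinQS4 G)
EraseBox-QCinQS4 (F C.or G)    = cong₂ C._or_ (EraseBox-QCinQS4 F) (EraseBox-QCinQS4 G)
EraseBox-QCinQS4 (F C.imp G)   = cong₂ C._imp_ (EraseBox-QCinQS4 F) (EraseBox-QCinQS4 G)
EraseBox-QCinQS4 (C.all F)     = cong C.all (EraseBox-QCinQS4 F)
EraseBox-QCinQS4 (C.ex F)      = cong C.ex (EraseBox-QCinQS4 F)

EraseBox-QCinQS4-MF : ∀ N → EraseBox.trMF (QCinQS4.trMF N) ≡ N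
EraseBox-QCinQS4-MF (C.fm {⋆} F) = cong C.fm (EraseBox-QCinQS4 F)
EraseBox-QCinQS4-MF (A C.& B)    = cong₂ C._&_ (EraseBox-QCinQS4-MF A) (EraseBox-QCinQS4-MF B)
EraseBox-QCinQS4-MF (A C.⟹ B)   = cong₂ C._⟹_ (EraseBox-QCinQS4-MF A) (EraseBox-QCinQS4-MF B)
EraseBox-QCinQS4-MF (C.∀¹ A)     = cong C.∀¹ (EraseBox-QCinQS4-MF A)
EraseBox-QCinQS4-MF (C.∀² ⋆ a A) = cong (C.∀² ⋆ a) (EraseBox-QCinQS4-MF A)

module IntoS4 where
  open ≡-Reasoning

  -- E s a k is the index of the QS4 variable standing for the QHC variable of sort s, arity a and
  -- index k.  Both sorts share the QS4 variables of each arity, so a QHC binder ∀² s a also shifts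
  -- the indices of the other sort (extend).
  Env : Set
  Env = HSort → ℕ → ℕ → ℕ

  idEnv : Env
  idEnv s a k = k

  extend : Env → HSort → ℕ → Env
  extend E s a s′ a′ k =
    if does (a′ ≟ℕ a)
    then (if does (≟H s′ s) then M.lift (E s′ a′) k else suc (E s′ a′ k))
    else E s′ a′ k

  □ᴹ : M.Fm ⋆ → M.Fm ⋆
  □ᴹ = M.op □

  -- On i-formulas this is the Gödel–McKinsey–Tarski translation, and ?! becomes □.
  toS4 : Env → ∀ {s} → H.Fm s → M.Fm ⋆
  toS4-core : Env → H.Fm i → M.Fm ⋆

  toS4 E {c} (H.con ⊤h)    = M.con ⊤c
  toS4 E {c} (H.con ⊥h)    = M.con ⊥c
  toS4 E {c} (H.pv a k ts) = M.pv a (E c a k) ts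
  toS4 E {c} (H.op `? Φ)   = toS4 E Φ
  toS4 E {c} (F H.and G)   = toS4 E F M.and toS4 E G
  toS4 E {c} (F H.or G)    = toS4 E F M.or toS4 E G
  toS4 E {c} (F H.imp G)   = toS4 E F M.imp toS4 E G
  toS4 E {c} (H.all F)     = M.all (toS4 E F)
  toS4 E {c} (H.ex F)      = M.ex (toS4 E F)
  toS4 E {i} Φ             = □ᴹ (toS4-core E Φ)

  toS4-core E (H.con ✓h)    = M.con ⊤c
  toS4-core E (H.con ⋏h)    = M.con ⊥c
  toS4-core E (H.pv a k ts) = M.pv a (E i a k) ts
  toS4-core E (H.op `! F)   = toS4 E F
  toS4-core E (Φ H.and Ψ)   = toS4 E Φ M.and toS4 E Ψ
  toS4-core E (Φ H.or Ψ)    = toS4 E Φ M.or toS4 E Ψ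
  toS4-core E (Φ H.imp Ψ)   = toS4 E Φ M.imp toS4 E Ψ
  toS4-core E (H.all Φ)     = M.all (toS4 E Φ)
  toS4-core E (H.ex Φ)      = M.ex (toS4 E Φ)

  toS4-MF : Env → H.MF → M.MF
  toS4-MF E (H.fm F)     = M.fm (toS4 E F)
  toS4-MF E (A H.& B)    = toS4-MF E A M.& toS4-MF E B
  toS4-MF E (A H.⟹ B)   = toS4-MF E A M.⟹ toS4-MF E B
  toS4-MF E (H.∀¹ A)     = M.∀¹ (toS4-MF E A)
  toS4-MF E (H.∀² s a A) = M.∀² ⋆ a (toS4-MF (extend E s a) A)

  -- An i-variable α becomes □α, so a substituend Φ for α becomes toS4-core Φ.
  toS4-sub : Env → ∀ s → H.Fm s → M.Fm ⋆
  toS4-sub E c G = toS4 E G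
  toS4-sub E i G = toS4-core E G

  toS4-ren : ∀ E ρ {s} (F : H.Fm s) → toS4 E (H.ren ρ F) ≡ M.ren ρ (toS4 E F)
  toS4-core-ren : ∀ E ρ (Φ : H.Fm i) → toS4-core E (H.ren ρ Φ) ≡ M.ren ρ (toS4-core E Φ)
  toS4-ren E ρ {c} (H.con ⊤h)    = refl
  toS4-ren E ρ {c} (H.con ⊥h)    = refl
  toS4-ren E ρ {c} (H.pv a k ts) = refl
  toS4-ren E ρ {c} (H.op `? Φ)   = toS4-ren E ρ Φ
  toS4-ren E ρ {c} (F H.and G)   = cong₂ M._and_ (toS4-ren E ρ F) (toS4-ren E ρ G)
  toS4-ren E ρ {c} (F H.or G)    = cong₂ M._or_ (toS4-ren E ρ F) (toS4-ren E ρ G)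
  toS4-ren E ρ {c} (F H.imp G)   = cong₂ M._imp_ (toS4-ren E ρ F) (toS4-ren E ρ G)
  toS4-ren E ρ {c} (H.all F)     = cong M.all (toS4-ren E (H.lift ρ) F)
  toS4-ren E ρ {c} (H.ex F)      = cong M.ex (toS4-ren E (H.lift ρ) F)
  toS4-ren E ρ {i} Φ             = cong □ᴹ (toS4-core-ren E ρ Φ)
  toS4-core-ren E ρ (H.con ✓h)    = refl
  toS4-core-ren E ρ (H.con ⋏h)    = refl
  toS4-core-ren E ρ (H.pv a k ts) = refl
  toS4-core-ren E ρ (H.op `! F)   = toS4-ren E ρ F
  toS4-core-ren E ρ (Φ H.and Ψ)   = cong₂ M._and_ (toS4-ren E ρ Φ) (toS4-ren E ρ Ψ)
  toS4-core-ren E ρ (Φ H.or Ψ)    = cong₂ M._or_ (toS4-ren E ρ Φ) (toS4-ren E ρ Ψ)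
  toS4-core-ren E ρ (Φ H.imp Ψ)   = cong₂ M._imp_ (toS4-ren E ρ Φ) (toS4-ren E ρ Ψ)
  toS4-core-ren E ρ (H.all Φ)     = cong M.all (toS4-ren E (H.lift ρ) Φ)
  toS4-core-ren E ρ (H.ex Φ)      = cong M.ex (toS4-ren E (H.lift ρ) Φ)

  toS4-sub-ren : ∀ E ρ s (G : H.Fm s) → toS4-sub E s (H.ren ρ G) ≡ M.ren ρ (toS4-sub E s G)
  toS4-sub-ren E ρ c G = toS4-ren E ρ G
  toS4-sub-ren E ρ i G = toS4-core-ren E ρ G

  toS4-MF-renM : ∀ E ρ A → toS4-MF E (H.renM ρ A) ≡ M.renM ρ (toS4-MF E A)
  toS4-MF-renM E ρ (H.fm F)     = cong M.fm (toS4-ren E ρ F)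
  toS4-MF-renM E ρ (A H.& B)    = cong₂ M._&_ (toS4-MF-renM E ρ A) (toS4-MF-renM E ρ B)
  toS4-MF-renM E ρ (A H.⟹ B)   = cong₂ M._⟹_ (toS4-MF-renM E ρ A) (toS4-MF-renM E ρ B)
  toS4-MF-renM E ρ (H.∀¹ A)     = cong M.∀¹ (toS4-MF-renM E (H.lift ρ) A)
  toS4-MF-renM E ρ (H.∀² s a A) = cong (M.∀² ⋆ a) (toS4-MF-renM (extend E s a) ρ A)

  extend-same : ∀ E s a k → extend E s a s a k ≡ M.lift (E s a) k
  extend-same E c a k rewrite ≡ᵇ-refl a = refl
  extend-same E i a k rewrite ≡ᵇ-refl a = refl

  other : HSort → HSort
  other c = i
  other i = c

  other≢ : ∀ s → other s ≢ s
  other≢ c ()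
  other≢ i ()

  ≢other : ∀ s → s ≢ other s
  ≢other c ()
  ≢other i ()

  ≢⇒other : ∀ {s s′} → s′ ≢ s → s′ ≡ other s
  ≢⇒other {c} {c} ne = ⊥-elim (ne refl)
  ≢⇒other {c} {i} ne = refl
  ≢⇒other {i} {c} ne = refl
  ≢⇒other {i} {i} ne = ⊥-elim (ne refl)

  extend-other-sort : ∀ E s s′ a k → s′ ≢ s → extend E s a s′ a k ≡ suc (E s′ a k)
  extend-other-sort E c c a k s′≢s = ⊥-elim (s′≢s refl)
  extend-other-sort E c i a k s′≢s rewrite ≡ᵇ-refl a = refl
  extend-other-sort E i c a k s′≢s rewrite ≡ᵇ-refl a = refl
  extend-other-sort E i i a k s′≢s = ⊥-elim (s′≢s refl)

  extend-other-arity : ∀ E s s′ a a′ k → a′ ≢ a → extend E s a s′ a′ k ≡ E s′ a′ k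
  extend-other-arity E s s′ a a′ k a′≢a rewrite ≡ᵇ-false a′≢a = refl

  extend-cong : ∀ {E E′} s a s′ a′ → (∀ k → E′ s′ a′ k ≡ E s′ a′ k)
    → ∀ k → extend E′ s a s′ a′ k ≡ extend E s a s′ a′ k
  extend-cong s a s′ a′ eq k with does (a′ ≟ℕ a) | does (≟H s′ s)
  ... | false | _     = eq k
  ... | true  | false = cong suc (eq k)
  ... | true  | true  with k
  ...   | zero  = refl
  ...   | suc n = cong suc (eq n)

  boxIf : HSort → M.Fm ⋆ → M.Fm ⋆
  boxIf c X = X
  boxIf i X = □ᴹ X

  toS4-pv : ∀ E s a k ts → toS4 E (H.pv {s} a k ts) ≡ boxIf s (M.pv a (E s a k) ts)
  toS4-pv E c a k ts = refl
  toS4-pv E i a k ts = refl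

  shiftP-toS4-pv : ∀ E s a k ts {a₀ cut}
    → M.shiftP ⋆ a₀ cut (toS4 E (H.pv {s} a k ts))
      ≡ boxIf s (M.shiftP ⋆ a₀ cut (M.pv a (E s a k) ts))
  shiftP-toS4-pv E c a k ts = refl
  shiftP-toS4-pv E i a k ts = refl

  □ᴹ-injective : ∀ {X Y} → □ᴹ X ≡ □ᴹ Y → X ≡ Y
  □ᴹ-injective refl = refl

  -- The conditions on environments under which toS4 E′ ∘ H.shiftP s a cH = M.shiftP ⋆ a cM ∘ toS4 E.
  record ShiftRel (s : HSort) (a cH cM : ℕ) (E E′ : Env) : Set where
    field
      same-sort   : ∀ k → E′ s a (shiftIdx cH k) ≡ shiftIdx cM (E s a k)
      other-sort  : ∀ k → E′ (other s) a k ≡ shiftIdx cM (E (other s) a k)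
      other-arity : ∀ s′ a′ k → a′ ≢ a → E′ s′ a′ k ≡ E s′ a′ k
  open ShiftRel

  toS4-shiftP-pv : ∀ {s a cH cM E E′} → ShiftRel s a cH cM E E′ → ∀ s′ a′ k ts
    → toS4 E′ (H.shiftP s a cH (H.pv {s′} a′ k ts))
      ≡ M.shiftP ⋆ a cM (toS4 E (H.pv {s′} a′ k ts))
  toS4-shiftP-pv {s} {a} {cH} {cM} {E} {E′} r s′ a′ k ts with HP.classView s a s′ a′
  ... | HP.same = begin
    toS4 E′ (H.shiftP s a cH (H.pv {s} a k ts))
      ≡⟨ cong (toS4 E′) (HP.shiftP-pv {s} cH k ts) ⟩
    toS4 E′ (H.pv {s} a (shiftIdx cH k) ts)
      ≡⟨ toS4-pv E′ s a _ ts ⟩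
    boxIf s (M.pv a (E′ s a (shiftIdx cH k)) ts)
      ≡⟨ cong (λ n → boxIf s (M.pv a n ts)) (same-sort r k) ⟩
    boxIf s (M.pv a (shiftIdx cM (E s a k)) ts)
      ≡⟨ cong (boxIf s) (MP.shiftP-pv cM (E s a k) ts) ⟨
    boxIf s (M.shiftP ⋆ a cM (M.pv a (E s a k) ts))
      ≡⟨ shiftP-toS4-pv E s a k ts ⟨
    M.shiftP ⋆ a cM (toS4 E (H.pv {s} a k ts))
      ∎
  ... | HP.different ne = begin
    toS4 E′ (H.shiftP s a cH (H.pv {s′} a′ k ts))
      ≡⟨ cong (toS4 E′) (HP.shiftP-pv-≢ cH ts ne) ⟩
    toS4 E′ (H.pv {s′} a′ k ts)
      ≡⟨ toS4-pv E′ s′ a′ k ts ⟩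
    boxIf s′ (M.pv a′ (E′ s′ a′ k) ts)
      ≡⟨ cong (boxIf s′) (other-class (a′ ≟ℕ a)) ⟩
    boxIf s′ (M.shiftP ⋆ a cM (M.pv a′ (E s′ a′ k) ts))
      ≡⟨ shiftP-toS4-pv E s′ a′ k ts ⟨
    M.shiftP ⋆ a cM (toS4 E (H.pv {s′} a′ k ts))
      ∎
    where
    other-class : Dec (a′ ≡ a)
      → M.pv a′ (E′ s′ a′ k) ts ≡ M.shiftP ⋆ a cM (M.pv a′ (E s′ a′ k) ts)
    other-class (yes refl) = trans (cong (λ n → M.pv a n ts) other-sort′) (sym (MP.shiftP-pv cM _ ts))
      where
      other-sort′ : E′ s′ a k ≡ shiftIdx cM (E s′ a k)
      other-sort′ = subst (λ x → E′ x a k ≡ shiftIdx cM (E x a k))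
                          (sym (≢⇒other (ne ∘ (_, refl)))) (other-sort r k)
    other-class (no a′≢a) = trans (cong (λ n → M.pv a′ n ts) (other-arity r s′ a′ k a′≢a))
                                  (sym (MP.shiftP-pv-≢ cM ts (a′≢a ∘ proj₂)))

  toS4-shiftP : ∀ {s a cH cM E E′} → ShiftRel s a cH cM E E′ → ∀ {t} (F : H.Fm t)
    → toS4 E′ (H.shiftP s a cH F) ≡ M.shiftP ⋆ a cM (toS4 E F)
  toS4-core-shiftP : ∀ {s a cH cM E E′} → ShiftRel s a cH cM E E′ → ∀ (Φ : H.Fm i)
    → toS4-core E′ (H.shiftP s a cH Φ) ≡ M.shiftP ⋆ a cM (toS4-core E Φ)
  toS4-shiftP r {c} (H.con ⊤h)    = refl
  toS4-shiftP r {c} (H.con ⊥h)    = refl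
  toS4-shiftP r {c} (H.pv a k ts) = toS4-shiftP-pv r c a k ts
  toS4-shiftP r {c} (H.op `? Φ)   = toS4-shiftP r Φ
  toS4-shiftP r {c} (F H.and G)   = cong₂ M._and_ (toS4-shiftP r F) (toS4-shiftP r G)
  toS4-shiftP r {c} (F H.or G)    = cong₂ M._or_ (toS4-shiftP r F) (toS4-shiftP r G)
  toS4-shiftP r {c} (F H.imp G)   = cong₂ M._imp_ (toS4-shiftP r F) (toS4-shiftP r G)
  toS4-shiftP r {c} (H.all F)     = cong M.all (toS4-shiftP r F)
  toS4-shiftP r {c} (H.ex F)      = cong M.ex (toS4-shiftP r F)
  toS4-shiftP r {i} Φ             = cong □ᴹ (toS4-core-shiftP r Φ)
  toS4-core-shiftP r (H.con ✓h)    = refl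
  toS4-core-shiftP r (H.con ⋏h)    = refl
  toS4-core-shiftP r (H.pv a k ts) = □ᴹ-injective (toS4-shiftP-pv r i a k ts)
  toS4-core-shiftP r (H.op `! F)   = toS4-shiftP r F
  toS4-core-shiftP r (Φ H.and Ψ)   = cong₂ M._and_ (toS4-shiftP r Φ) (toS4-shiftP r Ψ)
  toS4-core-shiftP r (Φ H.or Ψ)    = cong₂ M._or_ (toS4-shiftP r Φ) (toS4-shiftP r Ψ)
  toS4-core-shiftP r (Φ H.imp Ψ)   = cong₂ M._imp_ (toS4-shiftP r Φ) (toS4-shiftP r Ψ)
  toS4-core-shiftP r (H.all Φ)     = cong M.all (toS4-shiftP r Φ)
  toS4-core-shiftP r (H.ex Φ)      = cong M.ex (toS4-shiftP r Φ)

  shiftRel-extend-same : ∀ {s a cH cM E E′} → ShiftRel s a cH cM E E′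
    → ShiftRel s a (suc cH) (suc cM) (extend E s a) (extend E′ s a)
  same-sort (shiftRel-extend-same {s} {a} {cH} {cM} {E} {E′} r) zero
    rewrite extend-same E′ s a 0 | extend-same E s a 0 = refl
  same-sort (shiftRel-extend-same {s} {a} {cH} {cM} {E} {E′} r) (suc k)
    rewrite shiftIdx-suc cH k
          | extend-same E′ s a (suc (shiftIdx cH k))
          | extend-same E s a (suc k)
          | shiftIdx-suc cM (E s a k)
    = cong suc (same-sort r k)
  other-sort (shiftRel-extend-same {s} {a} {cH} {cM} {E} {E′} r) k
    rewrite extend-other-sort E′ s (other s) a k (other≢ s)
          | extend-other-sort E s (other s) a k (other≢ s)
          | shiftIdx-suc cM (E (other s) a k)
    = cong suc (other-sort r k)
  other-arity (shiftRel-extend-same {s} {a} {cH} {cM} {E} {E′} r) s′ a′ k a′≢a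
    rewrite extend-other-arity E′ s s′ a a′ k a′≢a | extend-other-arity E s s′ a a′ k a′≢a
    = other-arity r s′ a′ k a′≢a

  shiftRel-extend-other-sort : ∀ {s a cH cM E E′} → ShiftRel s a cH cM E E′
    → ShiftRel s a cH (suc cM) (extend E (other s) a) (extend E′ (other s) a)
  same-sort (shiftRel-extend-other-sort {s} {a} {cH} {cM} {E} {E′} r) k
    rewrite extend-other-sort E′ (other s) s a (shiftIdx cH k) (≢other s)
          | extend-other-sort E (other s) s a k (≢other s)
          | shiftIdx-suc cM (E s a k)
    = cong suc (same-sort r k)
  other-sort (shiftRel-extend-other-sort {s} {a} {cH} {cM} {E} {E′} r) zero
    rewrite extend-same E′ (other s) a 0 | extend-same E (other s) a 0 = refl
  other-sort (shiftRel-extend-other-sort {s} {a} {cH} {cM} {E} {E′} r) (suc k)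
    rewrite extend-same E′ (other s) a (suc k)
          | extend-same E (other s) a (suc k)
          | shiftIdx-suc cM (E (other s) a k)
    = cong suc (other-sort r k)
  other-arity (shiftRel-extend-other-sort {s} {a} {E = E} {E′} r) s′ a′ k a′≢a =
    extend-cong {E} {E′} (other s) a s′ a′ (λ k → other-arity r s′ a′ k a′≢a) k

  shiftRel-extend-other-arity : ∀ {s a cH cM E E′} → ShiftRel s a cH cM E E′ → ∀ s″ {a″} → a″ ≢ a
    → ShiftRel s a cH cM (extend E s″ a″) (extend E′ s″ a″)
  same-sort (shiftRel-extend-other-arity {s} {a} {cH} {cM} {E} {E′} r s″ {a″} a″≢a) k
    rewrite extend-other-arity E′ s″ s a″ a (shiftIdx cH k) (a″≢a ∘ sym)
          | extend-other-arity E s″ s a″ a k (a″≢a ∘ sym)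
    = same-sort r k
  other-sort (shiftRel-extend-other-arity {s} {a} {cH} {cM} {E} {E′} r s″ {a″} a″≢a) k
    rewrite extend-other-arity E′ s″ (other s) a″ a k (a″≢a ∘ sym)
          | extend-other-arity E s″ (other s) a″ a k (a″≢a ∘ sym)
    = other-sort r k
  other-arity (shiftRel-extend-other-arity {E = E} {E′} r s″ {a″} _) s′ a′ k a′≢a =
    extend-cong {E} {E′} s″ a″ s′ a′ (λ k → other-arity r s′ a′ k a′≢a) k

  shiftRel-extend : ∀ {s a cH cM E E′} → ShiftRel s a cH cM E E′ → ∀ s″ a″
    → ShiftRel s a (if H.sameClass s″ a″ s a then suc cH else cH)
                   (if M.sameClass ⋆ a″ ⋆ a then suc cM else cM)
                   (extend E s″ a″) (extend E′ s″ a″)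
  shiftRel-extend {s} {a} r s″ a″ with HP.classView s a s″ a″
  ... | HP.same rewrite HP.sameClass-refl s a | MP.sameClass-refl ⋆ a = shiftRel-extend-same r
  ... | HP.different ne with a″ ≟ℕ a
  ...   | yes refl rewrite HP.sameClass-≢ ne | MP.sameClass-refl ⋆ a | ≢⇒other (ne ∘ (_, refl)) =
          shiftRel-extend-other-sort r
  ...   | no a″≢a rewrite HP.sameClass-≢ ne | MP.sameClass-≢ {⋆} {a} {⋆} {a″} (a″≢a ∘ proj₂) =
          shiftRel-extend-other-arity r s″ a″≢a

  shiftRel-base : ∀ s a E → ShiftRel s a 0 0 E (extend E s a)
  same-sort (shiftRel-base s a E) k = extend-same E s a (suc k)
  other-sort (shiftRel-base s a E) k = extend-other-sort E s (other s) a k (other≢ s)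
  other-arity (shiftRel-base s a E) s′ a′ k a′≢a = extend-other-arity E s s′ a a′ k a′≢a

  toS4-MF-shiftPM : ∀ {s a cH cM E E′} → ShiftRel s a cH cM E E′ → ∀ A
    → toS4-MF E′ (H.shiftPM s a cH A) ≡ M.shiftPM ⋆ a cM (toS4-MF E A)
  toS4-MF-shiftPM r (H.fm F)       = cong M.fm (toS4-shiftP r F)
  toS4-MF-shiftPM r (A H.& B)      = cong₂ M._&_ (toS4-MF-shiftPM r A) (toS4-MF-shiftPM r B)
  toS4-MF-shiftPM r (A H.⟹ B)     = cong₂ M._⟹_ (toS4-MF-shiftPM r A) (toS4-MF-shiftPM r B)
  toS4-MF-shiftPM r (H.∀¹ A)       = cong M.∀¹ (toS4-MF-shiftPM r A)
  toS4-MF-shiftPM r (H.∀² s″ a″ A) =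
    cong (M.∀² ⋆ a″) (toS4-MF-shiftPM (shiftRel-extend r s″ a″) A)

  toS4-sub-shiftP : ∀ s a E t (G : H.Fm t)
    → toS4-sub (extend E s a) t (H.shiftP s a 0 G) ≡ M.shiftP ⋆ a 0 (toS4-sub E t G)
  toS4-sub-shiftP s a E c G = toS4-shiftP (shiftRel-base s a E) G
  toS4-sub-shiftP s a E i G = toS4-core-shiftP (shiftRel-base s a E) G

  -- Skips j n m: substituting for the QS4 variable j leaves the variable n as the variable m.
  Skips : ℕ → ℕ → ℕ → Set
  Skips j n m = (n < j × m ≡ n) ⊎ (j < n × m ≡ pred n)

  skips-zero : ∀ {j} → Skips (suc j) 0 0
  skips-zero = inj₁ (z<s , refl)

  skips-suc : ∀ {j n m} → Skips j n m → Skips (suc j) (suc n) (suc m)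
  skips-suc (inj₁ (n<j , refl))           = inj₁ (s≤s n<j , refl)
  skips-suc {n = suc n} (inj₂ (j<n , refl)) = inj₂ (s≤s j<n , refl)

  substP-pv-skips : ∀ {a j n m G} ts → Skips j n m
    → M.substP ⋆ a j G (M.pv {⋆} a n ts) ≡ M.pv a m ts
  substP-pv-skips ts (inj₁ (n<j , refl)) = MP.substP-pv-< ts n<j
  substP-pv-skips ts (inj₂ (j<n , refl)) = MP.substP-pv-> ts j<n

  toS4-ren-sub : ∀ E s ρ (G : H.Fm s) → toS4 E (H.ren ρ G) ≡ boxIf s (M.ren ρ (toS4-sub E s G))
  toS4-ren-sub E c ρ G = toS4-ren E ρ G
  toS4-ren-sub E i ρ G = cong □ᴹ (toS4-core-ren E ρ G)

  -- The conditions on environments under which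
  -- toS4 E ∘ H.substP s a jH G = M.substP ⋆ a jM (toS4-sub E s G) ∘ toS4 E′.
  record SubstRel (s : HSort) (a jH jM : ℕ) (E′ E : Env) : Set where
    field
      hit         : E′ s a jH ≡ jM
      below       : ∀ k → k < jH → Skips jM (E′ s a k) (E s a k)
      above       : ∀ k → jH < k → Skips jM (E′ s a k) (E s a (pred k))
      other-sort  : ∀ k → Skips jM (E′ (other s) a k) (E (other s) a k)
      other-arity : ∀ s′ a′ k → a′ ≢ a → E′ s′ a′ k ≡ E s′ a′ k
  open SubstRel

  substP-toS4-pv : ∀ E s a k ts {a₀ j G}
    → M.substP ⋆ a₀ j G (toS4 E (H.pv {s} a k ts))
      ≡ boxIf s (M.substP ⋆ a₀ j G (M.pv a (E s a k) ts))
  substP-toS4-pv E c a k ts = refl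
  substP-toS4-pv E i a k ts = refl

  toS4-substP-pv-same : ∀ {s a jH jM E′ E} → SubstRel s a jH jM E′ E → ∀ G k ts
    → toS4 E (H.substP s a jH G (H.pv {s} a k ts))
      ≡ M.substP ⋆ a jM (toS4-sub E s G) (toS4 E′ (H.pv {s} a k ts))
  toS4-substP-pv-same {s} {a} {jH} {jM} {E′} {E} r G k ts with <-cmp k jH
  ... | tri< k<j _ _ = begin
    toS4 E (H.substP s a jH G (H.pv {s} a k ts))
      ≡⟨ cong (toS4 E) (HP.substP-pv-< {s} ts k<j) ⟩
    toS4 E (H.pv {s} a k ts)
      ≡⟨ toS4-pv E s a k ts ⟩
    boxIf s (M.pv a (E s a k) ts)
      ≡⟨ cong (boxIf s) (substP-pv-skips ts (below r k k<j)) ⟨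
    boxIf s (M.substP ⋆ a jM (toS4-sub E s G) (M.pv a (E′ s a k) ts))
      ≡⟨ substP-toS4-pv E′ s a k ts ⟨
    M.substP ⋆ a jM (toS4-sub E s G) (toS4 E′ (H.pv {s} a k ts))
      ∎
  ... | tri> _ _ j<k = begin
    toS4 E (H.substP s a jH G (H.pv {s} a k ts))
      ≡⟨ cong (toS4 E) (HP.substP-pv-> {s} ts j<k) ⟩
    toS4 E (H.pv {s} a (pred k) ts)
      ≡⟨ toS4-pv E s a (pred k) ts ⟩
    boxIf s (M.pv a (E s a (pred k)) ts)
      ≡⟨ cong (boxIf s) (substP-pv-skips ts (above r k j<k)) ⟨
    boxIf s (M.substP ⋆ a jM (toS4-sub E s G) (M.pv a (E′ s a k) ts))
      ≡⟨ substP-toS4-pv E′ s a k ts ⟨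
    M.substP ⋆ a jM (toS4-sub E s G) (toS4 E′ (H.pv {s} a k ts))
      ∎
  ... | tri≈ _ refl _ = begin
    toS4 E (H.substP s a k G (H.pv {s} a k ts))
      ≡⟨ cong (toS4 E) (HP.substP-pv-hit {s} ts) ⟩
    toS4 E (H.ren (H.pick ts) G)
      ≡⟨ toS4-ren-sub E s (H.pick ts) G ⟩
    boxIf s (M.ren (M.pick ts) (toS4-sub E s G))
      ≡⟨ cong (boxIf s) (MP.substP-pv-hit ts) ⟨
    boxIf s (M.substP ⋆ a jM (toS4-sub E s G) (M.pv a jM ts))
      ≡⟨ cong (λ n → boxIf s (M.substP ⋆ a jM _ (M.pv a n ts))) (hit r) ⟨
    boxIf s (M.substP ⋆ a jM (toS4-sub E s G) (M.pv a (E′ s a k) ts))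
      ≡⟨ substP-toS4-pv E′ s a k ts ⟨
    M.substP ⋆ a jM (toS4-sub E s G) (toS4 E′ (H.pv {s} a k ts))
      ∎

  toS4-substP-pv : ∀ {s a jH jM E′ E} → SubstRel s a jH jM E′ E → ∀ G s′ a′ k ts
    → toS4 E (H.substP s a jH G (H.pv {s′} a′ k ts))
      ≡ M.substP ⋆ a jM (toS4-sub E s G) (toS4 E′ (H.pv {s′} a′ k ts))
  toS4-substP-pv {s} {a} {jH} {jM} {E′} {E} r G s′ a′ k ts with HP.classView s a s′ a′
  ... | HP.same = toS4-substP-pv-same r G k ts
  ... | HP.different ne = begin
    toS4 E (H.substP s a jH G (H.pv {s′} a′ k ts))
      ≡⟨ cong (toS4 E) (HP.substP-pv-≢ ts ne) ⟩
    toS4 E (H.pv {s′} a′ k ts)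
      ≡⟨ toS4-pv E s′ a′ k ts ⟩
    boxIf s′ (M.pv a′ (E s′ a′ k) ts)
      ≡⟨ cong (boxIf s′) (other-class (a′ ≟ℕ a)) ⟨
    boxIf s′ (M.substP ⋆ a jM (toS4-sub E s G) (M.pv a′ (E′ s′ a′ k) ts))
      ≡⟨ substP-toS4-pv E′ s′ a′ k ts ⟨
    M.substP ⋆ a jM (toS4-sub E s G) (toS4 E′ (H.pv {s′} a′ k ts))
      ∎
    where
    other-class : Dec (a′ ≡ a)
      → M.substP ⋆ a jM (toS4-sub E s G) (M.pv a′ (E′ s′ a′ k) ts) ≡ M.pv a′ (E s′ a′ k) ts
    other-class (yes refl) = substP-pv-skips ts
      (subst (λ x → Skips jM (E′ x a k) (E x a k)) (sym (≢⇒other (ne ∘ (_, refl))))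
             (other-sort r k))
    other-class (no a′≢a) = trans (MP.substP-pv-≢ {⋆} ts (a′≢a ∘ proj₂))
                                  (cong (λ n → M.pv a′ n ts) (other-arity r s′ a′ k a′≢a))

  toS4-substP : ∀ {s a jH jM E′ E} → SubstRel s a jH jM E′ E → ∀ G {t} (F : H.Fm t)
    → toS4 E (H.substP s a jH G F) ≡ M.substP ⋆ a jM (toS4-sub E s G) (toS4 E′ F)
  toS4-core-substP : ∀ {s a jH jM E′ E} → SubstRel s a jH jM E′ E → ∀ G (Φ : H.Fm i)
    → toS4-core E (H.substP s a jH G Φ) ≡ M.substP ⋆ a jM (toS4-sub E s G) (toS4-core E′ Φ)
  toS4-substP-under-binder : ∀ {s a jH jM E′ E} → SubstRel s a jH jM E′ E → ∀ G {t} (F : H.Fm t)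
    → toS4 E (H.substP s a jH (H.ambShift a G) F)
      ≡ M.substP ⋆ a jM (M.ambShift a (toS4-sub E s G)) (toS4 E′ F)
  toS4-substP r G {c} (H.con ⊤h)    = refl
  toS4-substP r G {c} (H.con ⊥h)    = refl
  toS4-substP r G {c} (H.pv a k ts) = toS4-substP-pv r G c a k ts
  toS4-substP r G {c} (H.op `? Φ)   = toS4-substP r G Φ
  toS4-substP r G {c} (F H.and F′)  = cong₂ M._and_ (toS4-substP r G F) (toS4-substP r G F′)
  toS4-substP r G {c} (F H.or F′)   = cong₂ M._or_ (toS4-substP r G F) (toS4-substP r G F′)
  toS4-substP r G {c} (F H.imp F′)  = cong₂ M._imp_ (toS4-substP r G F) (toS4-substP r G F′)
  toS4-substP r G {c} (H.all F)     = cong M.all (toS4-substP-under-binder r G F)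
  toS4-substP r G {c} (H.ex F)      = cong M.ex (toS4-substP-under-binder r G F)
  toS4-substP r G {i} Φ             = cong □ᴹ (toS4-core-substP r G Φ)
  toS4-core-substP r G (H.con ✓h)    = refl
  toS4-core-substP r G (H.con ⋏h)    = refl
  toS4-core-substP r G (H.pv a k ts) = □ᴹ-injective (toS4-substP-pv r G i a k ts)
  toS4-core-substP r G (H.op `! F)   = toS4-substP r G F
  toS4-core-substP r G (Φ H.and Ψ)   = cong₂ M._and_ (toS4-substP r G Φ) (toS4-substP r G Ψ)
  toS4-core-substP r G (Φ H.or Ψ)    = cong₂ M._or_ (toS4-substP r G Φ) (toS4-substP r G Ψ)
  toS4-core-substP r G (Φ H.imp Ψ)   = cong₂ M._imp_ (toS4-substP r G Φ) (toS4-substP r G Ψ)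
  toS4-core-substP r G (H.all Φ)     = cong M.all (toS4-substP-under-binder r G Φ)
  toS4-core-substP r G (H.ex Φ)      = cong M.ex (toS4-substP-under-binder r G Φ)
  toS4-substP-under-binder {s} {a} {jM = jM} {E′} {E} r G F =
    trans (toS4-substP r (H.ambShift a G) F)
          (cong (λ X → M.substP ⋆ a jM X (toS4 E′ F)) (toS4-sub-ren E _ s G))

  substRel-extend-same : ∀ {s a jH jM E′ E} → SubstRel s a jH jM E′ E
    → SubstRel s a (suc jH) (suc jM) (extend E′ s a) (extend E s a)
  hit (substRel-extend-same {s} {a} {jH} {E′ = E′} r)
    rewrite extend-same E′ s a (suc jH) = cong suc (hit r)
  below (substRel-extend-same {s} {a} {E′ = E′} {E} r) zero _
    rewrite extend-same E′ s a 0 | extend-same E s a 0 = skips-zero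
  below (substRel-extend-same {s} {a} {E′ = E′} {E} r) (suc k) (s≤s k<j)
    rewrite extend-same E′ s a (suc k) | extend-same E s a (suc k) = skips-suc (below r k k<j)
  above (substRel-extend-same {s} {a} {E′ = E′} {E} r) (suc (suc k)) (s≤s j<k)
    rewrite extend-same E′ s a (suc (suc k)) | extend-same E s a (suc k) = skips-suc (above r (suc k) j<k)
  other-sort (substRel-extend-same {s} {a} {E′ = E′} {E} r) k
    rewrite extend-other-sort E′ s (other s) a k (other≢ s)
          | extend-other-sort E s (other s) a k (other≢ s)
    = skips-suc (other-sort r k)
  other-arity (substRel-extend-same {s} {a} {E′ = E′} {E} r) s′ a′ k a′≢a =
    extend-cong {E} {E′} s a s′ a′ (λ k → other-arity r s′ a′ k a′≢a) k

  substRel-extend-other-sort : ∀ {s a jH jM E′ E} → SubstRel s a jH jM E′ E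
    → SubstRel s a jH (suc jM) (extend E′ (other s) a) (extend E (other s) a)
  hit (substRel-extend-other-sort {s} {a} {jH} {E′ = E′} r)
    rewrite extend-other-sort E′ (other s) s a jH (≢other s) = cong suc (hit r)
  below (substRel-extend-other-sort {s} {a} {E′ = E′} {E} r) k k<j
    rewrite extend-other-sort E′ (other s) s a k (≢other s)
          | extend-other-sort E (other s) s a k (≢other s)
    = skips-suc (below r k k<j)
  above (substRel-extend-other-sort {s} {a} {E′ = E′} {E} r) k j<k
    rewrite extend-other-sort E′ (other s) s a k (≢other s)
          | extend-other-sort E (other s) s a (pred k) (≢other s)
    = skips-suc (above r k j<k)
  other-sort (substRel-extend-other-sort {s} {a} {E′ = E′} {E} r) zero
    rewrite extend-same E′ (other s) a 0 | extend-same E (other s) a 0 = skips-zero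
  other-sort (substRel-extend-other-sort {s} {a} {E′ = E′} {E} r) (suc k)
    rewrite extend-same E′ (other s) a (suc k) | extend-same E (other s) a (suc k)
    = skips-suc (other-sort r k)
  other-arity (substRel-extend-other-sort {s} {a} {E′ = E′} {E} r) s′ a′ k a′≢a =
    extend-cong {E} {E′} (other s) a s′ a′ (λ k → other-arity r s′ a′ k a′≢a) k

  substRel-extend-other-arity : ∀ {s a jH jM E′ E} → SubstRel s a jH jM E′ E → ∀ s″ {a″} → a″ ≢ a
    → SubstRel s a jH jM (extend E′ s″ a″) (extend E s″ a″)
  hit (substRel-extend-other-arity {s} {a} {jH} {E′ = E′} r s″ {a″} a″≢a)
    rewrite extend-other-arity E′ s″ s a″ a jH (a″≢a ∘ sym) = hit r
  below (substRel-extend-other-arity {s} {a} {E′ = E′} {E} r s″ {a″} a″≢a) k k<j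
    rewrite extend-other-arity E′ s″ s a″ a k (a″≢a ∘ sym)
          | extend-other-arity E s″ s a″ a k (a″≢a ∘ sym)
    = below r k k<j
  above (substRel-extend-other-arity {s} {a} {E′ = E′} {E} r s″ {a″} a″≢a) k j<k
    rewrite extend-other-arity E′ s″ s a″ a k (a″≢a ∘ sym)
          | extend-other-arity E s″ s a″ a (pred k) (a″≢a ∘ sym)
    = above r k j<k
  other-sort (substRel-extend-other-arity {s} {a} {E′ = E′} {E} r s″ {a″} a″≢a) k
    rewrite extend-other-arity E′ s″ (other s) a″ a k (a″≢a ∘ sym)
          | extend-other-arity E s″ (other s) a″ a k (a″≢a ∘ sym)
    = other-sort r k
  other-arity (substRel-extend-other-arity {E′ = E′} {E} r s″ {a″} _) s′ a′ k a′≢a =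
    extend-cong {E} {E′} s″ a″ s′ a′ (λ k → other-arity r s′ a′ k a′≢a) k

  substRel-extend : ∀ {s a jH jM E′ E} → SubstRel s a jH jM E′ E → ∀ s″ a″
    → SubstRel s a (if H.sameClass s″ a″ s a then suc jH else jH)
                   (if M.sameClass ⋆ a″ ⋆ a then suc jM else jM)
               (extend E′ s″ a″) (extend E s″ a″)
  substRel-extend {s} {a} r s″ a″ with HP.classView s a s″ a″
  ... | HP.same rewrite HP.sameClass-refl s a | MP.sameClass-refl ⋆ a = substRel-extend-same r
  ... | HP.different ne with a″ ≟ℕ a
  ...   | yes refl rewrite HP.sameClass-≢ ne | MP.sameClass-refl ⋆ a | ≢⇒other (ne ∘ (_, refl)) =
          substRel-extend-other-sort r
  ...   | no a″≢a rewrite HP.sameClass-≢ ne | MP.sameClass-≢ {⋆} {a} {⋆} {a″} (a″≢a ∘ proj₂) =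
          substRel-extend-other-arity r s″ a″≢a

  substRel-base : ∀ s a E → SubstRel s a 0 0 (extend E s a) E
  hit (substRel-base s a E) = extend-same E s a 0
  below (substRel-base s a E) k ()
  above (substRel-base s a E) (suc k) _ rewrite extend-same E s a (suc k) = inj₂ (z<s , refl)
  other-sort (substRel-base s a E) k
    rewrite extend-other-sort E s (other s) a k (other≢ s) = inj₂ (z<s , refl)
  other-arity (substRel-base s a E) s′ a′ k a′≢a = extend-other-arity E s s′ a a′ k a′≢a

  toS4-MF-substPM : ∀ {s a jH jM E′ E} → SubstRel s a jH jM E′ E → ∀ G A
    → toS4-MF E (H.substPM s a jH G A) ≡ M.substPM ⋆ a jM (toS4-sub E s G) (toS4-MF E′ A)
  toS4-MF-substPM r G (H.fm F)   = cong M.fm (toS4-substP r G F)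
  toS4-MF-substPM r G (A H.& B)  = cong₂ M._&_ (toS4-MF-substPM r G A) (toS4-MF-substPM r G B)
  toS4-MF-substPM r G (A H.⟹ B) = cong₂ M._⟹_ (toS4-MF-substPM r G A) (toS4-MF-substPM r G B)
  toS4-MF-substPM {s} {a} {jM = jM} {E′} {E} r G (H.∀¹ A) = cong M.∀¹
    (trans (toS4-MF-substPM r (H.ambShift a G) A)
    (cong (λ X → M.substPM ⋆ a jM X (toS4-MF E′ A)) (toS4-sub-ren E _ s G)))
  toS4-MF-substPM {s} {a} {E′ = E′} {E} r G (H.∀² s″ a″ A) = cong (M.∀² ⋆ a″)
    (trans (toS4-MF-substPM (substRel-extend r s″ a″) (H.shiftP s″ a″ 0 G) A)
           (cong (λ X → M.substPM ⋆ a _ X (toS4-MF (extend E′ s″ a″) A)) (toS4-sub-shiftP s″ a″ E s G)))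

  map-toS4-MF-renM : ∀ E ρ Γ
    → map (toS4-MF E) (map (H.renM ρ) Γ) ≡ map (M.renM ρ) (map (toS4-MF E) Γ)
  map-toS4-MF-renM E ρ []      = refl
  map-toS4-MF-renM E ρ (A ∷ Γ) = cong₂ _∷_ (toS4-MF-renM E ρ A) (map-toS4-MF-renM E ρ Γ)

  map-toS4-MF-shiftPM : ∀ E s a Γ
    → map (toS4-MF (extend E s a)) (map (H.shiftPM s a 0) Γ)
      ≡ map (M.shiftPM ⋆ a 0) (map (toS4-MF E) Γ)
  map-toS4-MF-shiftPM E s a []      = refl
  map-toS4-MF-shiftPM E s a (A ∷ Γ) =
    cong₂ _∷_ (toS4-MF-shiftPM (shiftRel-base s a E) A) (map-toS4-MF-shiftPM E s a Γ)

  toS4-⊢ : ∀ E {Γ A} → Γ H.⊢ A → map (toS4-MF E) Γ M.⊢ toS4-MF E A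
  toS4-⊢ E (H.hyp A∈Γ) = M.hyp (∈-map⁺ (toS4-MF E) A∈Γ)
  toS4-⊢ E (H.&I d e)  = M.&I (toS4-⊢ E d) (toS4-⊢ E e)
  toS4-⊢ E (H.&E₁ d)   = M.&E₁ (toS4-⊢ E d)
  toS4-⊢ E (H.&E₂ d)   = M.&E₂ (toS4-⊢ E d)
  toS4-⊢ E (H.⟹I d)   = M.⟹I (toS4-⊢ E d)
  toS4-⊢ E (H.⟹E d e) = M.⟹E (toS4-⊢ E d) (toS4-⊢ E e)
  toS4-⊢ E {Γ} (H.∀¹I d) = M.∀¹I (subst (M._⊢ _) (map-toS4-MF-renM E suc Γ) (toS4-⊢ E d))
  toS4-⊢ E (H.∀¹E {M = A} d t) =
    subst (_ M.⊢_) (sym (toS4-MF-renM E (H.inst0 t) A)) (M.∀¹E (toS4-⊢ E d) t)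
  toS4-⊢ E {Γ} (H.∀²I {s = s} {a = a} d) =
    M.∀²I (subst (M._⊢ _) (map-toS4-MF-shiftPM E s a Γ) (toS4-⊢ (extend E s a) d))
  toS4-⊢ E (H.∀²E {s = s} {a = a} {M = A} d G) =
    subst (_ M.⊢_) (sym (toS4-MF-substPM (substRel-base s a E) G A))
                   (M.∀²E (toS4-⊢ E d) (toS4-sub E s G))

  toS4-derivable : ∀ E D D′ → (MP.⋀ D′ ∷ []) M.⊢ toS4-MF E (HP.⋀ D)
    → ∀ A → H.Derivable D A → M.Derivable D′ (toS4-MF E A)
  toS4-derivable E (R ∷ Rs) (R′ ∷ Rs′) D′⊢D A d = MP.cut (toS4-⊢ E d) D′⊢D

  IdentityOnC : Env → Set
  IdentityOnC E = ∀ a k → E c a k ≡ k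

  identityOnC-extend : ∀ {E} → IdentityOnC E → ∀ a → IdentityOnC (extend E c a)
  identityOnC-extend {E} idC a a′ k with a′ ≟ℕ a
  ... | no a′≢a  = trans (extend-other-arity E c c a a′ k a′≢a) (idC a′ k)
  ... | yes refl with k
  ...   | zero  = extend-same E c a 0
  ...   | suc n = trans (extend-same E c a (suc n)) (cong suc (idC a n))

  toS4-QS4inQHC : ∀ {E} → IdentityOnC E → ∀ F → toS4 E (QS4inQHC.tr F) ≡ F
  toS4-QS4inQHC idC (M.con ⊤c)    = refl
  toS4-QS4inQHC idC (M.con ⊥c)    = refl
  toS4-QS4inQHC idC (M.pv a k ts) = cong (λ n → M.pv a n ts) (idC a k)
  toS4-QS4inQHC idC (M.op □ F)    = cong □ᴹ (toS4-QS4inQHC idC F)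
  toS4-QS4inQHC idC (F M.and G)   = cong₂ M._and_ (toS4-QS4inQHC idC F) (toS4-QS4inQHC idC G)
  toS4-QS4inQHC idC (F M.or G)    = cong₂ M._or_ (toS4-QS4inQHC idC F) (toS4-QS4inQHC idC G)
  toS4-QS4inQHC idC (F M.imp G)   = cong₂ M._imp_ (toS4-QS4inQHC idC F) (toS4-QS4inQHC idC G)
  toS4-QS4inQHC idC (M.all F)     = cong M.all (toS4-QS4inQHC idC F)
  toS4-QS4inQHC idC (M.ex F)      = cong M.ex (toS4-QS4inQHC idC F)

  toS4-MF-QS4inQHC : ∀ {E} → IdentityOnC E → ∀ N → toS4-MF E (QS4inQHC.trMF N) ≡ N
  toS4-MF-QS4inQHC idC (M.fm {⋆} F) = cong M.fm (toS4-QS4inQHC idC F)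
  toS4-MF-QS4inQHC idC (A M.& B)    = cong₂ M._&_ (toS4-MF-QS4inQHC idC A) (toS4-MF-QS4inQHC idC B)
  toS4-MF-QS4inQHC idC (A M.⟹ B)   = cong₂ M._⟹_ (toS4-MF-QS4inQHC idC A) (toS4-MF-QS4inQHC idC B)
  toS4-MF-QS4inQHC idC (M.∀¹ A)     = cong M.∀¹ (toS4-MF-QS4inQHC idC A)
  toS4-MF-QS4inQHC {E} idC (M.∀² ⋆ a A) =
    cong (M.∀² ⋆ a) (toS4-MF-QS4inQHC (identityOnC-extend {E} idC a) A)

-- D-QC, D-QS4 and D-QHC all begin with the same 17 classical axioms (positions 0–16).  They are
-- followed by S4Ax.modal in D-QS4 (17–20), and by the intuitionistic i-axioms (17–32) and
-- HCAx.specific (33–45) in D-QHC.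
QS4⊢QCinQS4-QC-axioms : (MP.⋀ D-QS4 ∷ []) M.⊢ QCinQS4.trMF (CP.⋀ D-QC)
QS4⊢QCinQS4-QC-axioms = MP.⊢-replaceTail 16 axioms (MP.⊢-conjunct 16 axioms)
  where
  axioms : (MP.⋀ D-QS4 ∷ []) M.⊢ MP.⋀ D-QS4
  axioms = M.hyp (here refl)

QC⊢EraseBox-QS4-axioms : (CP.⋀ D-QC ∷ []) C.⊢ EraseBox.trMF (MP.⋀ D-QS4)
QC⊢EraseBox-QS4-axioms = CP.⊢-replaceTail 16 axioms
  (  CP.⊢-conjunct 16 axioms
  ⊗ ∀²I (⇒-refl p)
  ⊗ ∀²I (⇒-refl p)
  ⊗ ∀²I (∀²I (⇒-refl (p imp q)))
  ⊗ ∀²I (⟹I (hyp (here refl))))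
  where
  open C
  open CP using (_⊗_)
  axioms : (CP.⋀ D-QC ∷ []) ⊢ CP.⋀ D-QC
  axioms = hyp (here refl)
  open HilbertReasoning.Reasoning QCLang ⋆ ⊤c ⊥c
         (OneSortedHilbert.hilbertAxioms NoOp D-QC (_ , refl) axioms)
  p q : Fm ⋆
  p = pv 0 0 []
  q = pv 0 1 []

module QHCReasoning {Γ : List H.MF} (axioms : Γ H.⊢ HP.⋀ D-QHC) where
  open H
  module Sc = Schemata QHCLang c
  module Si = Schemata QHCLang i
  open Sc using (v₀; v₁; opˢ; _⇒ˢ_)
  open Si using () renaming (v₀ to γ; v₁ to δ; opˢ to opⁱ; _⇒ˢ_ to _⇒ⁱ_)
  open HilbertReasoning QHCLang c ⊤h ⊥h using (HilbertAxioms; module Reasoning)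

  axiom : ∀ n → Γ ⊢ HP.conjunct (HP.⋀ D-QHC) n
  axiom n = HP.⊢-conjunct n axioms

  c-axioms : HilbertAxioms Γ
  c-axioms = record
    { mp = axiom 14 ; K = axiom 0 ; S = axiom 1
    ; ∧-E₁ = axiom 2 ; ∧-E₂ = axiom 3 ; ∧-I = axiom 4
    ; ∨-I₁ = axiom 5 ; ∨-I₂ = axiom 6 ; ∨-E = axiom 7
    ; ⊥-E = axiom 8 ; ⊤-I = axiom 9
    }
  open Reasoning c-axioms public

  ?ᴴ : Fm i → Fm c
  ?ᴴ = op `?
  !ᴴ : Fm c → Fm i
  !ᴴ = op `!

  i-modusPonens : ∀ {Φ Ψ} → Γ ⊢ fm Φ → Γ ⊢ fm (Φ imp Ψ) → Γ ⊢ fm Ψ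
  i-modusPonens = Si.instantiateRule₂ γ (γ ⇒ⁱ δ) δ (axiom 31) _ _

  ?-→ : ∀ Φ Ψ → Γ ⊢ fm (?ᴴ (Φ imp Ψ) imp ?ᴴ Φ imp ?ᴴ Ψ)
  ?-→ = Si.instantiate₂ (opⁱ `? (γ ⇒ⁱ δ) ⇒ⁱ opⁱ `? γ ⇒ⁱ opⁱ `? δ) (axiom 35)

  !?-unit : ∀ Φ → Γ ⊢ fm (Φ imp !ᴴ (?ᴴ Φ))
  !?-unit = Si.instantiate₁ (γ ⇒ⁱ opⁱ `! (opⁱ `? γ)) (axiom 39)

  !-4 : ∀ F → Γ ⊢ fm (!ᴴ F imp !ᴴ (?ᴴ (!ᴴ F)))
  !-4 = Sc.instantiate₁ (opˢ `! v₀ ⇒ˢ opˢ `! (opˢ `? (opˢ `! v₀))) (axiom 42)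

  !-K : ∀ F G → Γ ⊢ fm (!ᴴ (F imp G) imp !ᴴ F imp !ᴴ G)
  !-K = Sc.instantiate₂ (opˢ `! (v₀ ⇒ˢ v₁) ⇒ˢ opˢ `! v₀ ⇒ˢ opˢ `! v₁) (axiom 43)

  !-elim : ∀ {F} → Γ ⊢ fm (!ᴴ F) → Γ ⊢ fm F
  !-elim = Sc.instantiateRule₁ (opˢ `! v₀) v₀ (axiom 44) _

  !-intro : ∀ {F} → Γ ⊢ fm F → Γ ⊢ fm (!ᴴ F)
  !-intro = Sc.instantiateRule₁ v₀ (opˢ `! v₀) (axiom 45) _

  ?-mono : ∀ {Φ Ψ} → Γ ⊢ fm (Φ imp Ψ) → Γ ⊢ fm (?ᴴ Φ imp ?ᴴ Ψ)
  ?-mono {Φ} {Ψ} Φ⇒Ψ = modusPonens (!-elim (i-modusPonens Φ⇒Ψ (!?-unit (Φ imp Ψ)))) (?-→ Φ Ψ)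

  ?!-nec : ∀ {F} → Γ ⊢ fm F → Γ ⊢ fm (?ᴴ (!ᴴ F))
  ?!-nec {F} ⊢F = !-elim (i-modusPonens (!-intro ⊢F) (!-4 F))

QHC⊢QS4inQHC-QS4-axioms : (HP.⋀ D-QHC ∷ []) H.⊢ QS4inQHC.trMF (MP.⋀ D-QS4)
QHC⊢QS4inQHC-QS4-axioms = HP.⊢-replaceTail 17 (hyp (here refl))
  (  axiom 41
  ⊗ ∀²I (?-mono (!-4 p))
  ⊗ ∀²I (∀²I (⇒-trans (?-mono (!-K p q)) (?-→ (!ᴴ p) (!ᴴ q))))
  ⊗ ∀²I (⟹I (QHCReasoning.?!-nec (hyp (there (here refl))) (hyp (here refl)))))
  where
  open H
  open HP using (_⊗_)
  open QHCReasoning {HP.⋀ D-QHC ∷ []} (hyp (here refl))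
  p q : Fm c
  p = pv 0 0 []
  q = pv 0 1 []

module S4Reasoning {Γ : List M.MF} (axioms : Γ M.⊢ MP.⋀ D-QS4) where
  open M
  open Schemata QS4Lang ⋆
  open HilbertReasoning QS4Lang ⋆ ⊤c ⊥c using (module Reasoning)
  open IntoS4 using (□ᴹ)

  axiom : ∀ n → Γ ⊢ MP.conjunct (MP.⋀ D-QS4) n
  axiom n = MP.⊢-conjunct n axioms

  open Reasoning (OneSortedHilbert.hilbertAxioms BoxOp D-QS4 (_ , refl) axioms) public

  □-T : ∀ A → Γ ⊢ fm (□ᴹ A imp A)
  □-T = instantiate₁ (opˢ □ v₀ ⇒ˢ v₀) (axiom 17)

  □-4 : ∀ A → Γ ⊢ fm (□ᴹ A imp □ᴹ (□ᴹ A))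
  □-4 = instantiate₁ (opˢ □ v₀ ⇒ˢ opˢ □ (opˢ □ v₀)) (axiom 18)

  □-K : ∀ A B → Γ ⊢ fm (□ᴹ (A imp B) imp □ᴹ A imp □ᴹ B)
  □-K = instantiate₂ (opˢ □ (v₀ ⇒ˢ v₁) ⇒ˢ opˢ □ v₀ ⇒ˢ opˢ □ v₁) (axiom 19)

  □-nec : ∀ {A} → Γ ⊢ fm A → Γ ⊢ fm (□ᴹ A)
  □-nec = instantiateRule₁ v₀ (opˢ □ v₀) (axiom 20) _

  □E : ∀ {Δ A} → Δ ⊢ʰ □ᴹ A → Δ ⊢ʰ A
  □E {A = A} ⊢□A = theorem (□-T A) · ⊢□A

  □□I : ∀ {Δ A} → Δ ⊢ʰ □ᴹ A → Δ ⊢ʰ □ᴹ (□ᴹ A)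
  □□I {A = A} ⊢□A = theorem (□-4 A) · ⊢□A

  □-app : ∀ {Δ A B} → Δ ⊢ʰ □ᴹ (A imp B) → Δ ⊢ʰ □ᴹ A → Δ ⊢ʰ □ᴹ B
  □-app {A = A} {B} ⊢□A⇒B ⊢□A = theorem (□-K A B) · ⊢□A⇒B · ⊢□A

  □I₀ : ∀ {Δ B} → [] ⊢ʰ B → Δ ⊢ʰ □ᴹ B
  □I₀ ⊢B = theorem (□-nec (discharge ⊢B))

  □I₁ : ∀ {Δ A B} → □ᴹ A ∷ [] ⊢ʰ B → Δ ⊢ʰ □ᴹ A → Δ ⊢ʰ □ᴹ B
  □I₁ ⊢B ⊢□A = □-app (□I₀ (deduction ⊢B)) (□□I ⊢□A)

  □I₂ : ∀ {Δ A B C} → □ᴹ B ∷ □ᴹ A ∷ [] ⊢ʰ C → Δ ⊢ʰ □ᴹ A → Δ ⊢ʰ □ᴹ B → Δ ⊢ʰ □ᴹ C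
  □I₂ ⊢C ⊢□A ⊢□B = □-app (□-app (□I₀ (deduction (deduction ⊢C))) (□□I ⊢□A)) (□□I ⊢□B)

module TranslatedQHCAxioms where
  open M
  open IntoS4 using (□ᴹ; toS4-MF; idEnv)

  ΓS : List MF
  ΓS = MP.⋀ D-QS4 ∷ []

  open S4Reasoning {ΓS} (hyp (here refl))

  TranslatedAxiom : ℕ → MF
  TranslatedAxiom n = MP.conjunct (toS4-MF idEnv (HP.⋀ D-QHC)) n

  P : Fm ⋆
  P = pv 0 0 []
  θ : ℕ → Fm ⋆
  θ x = pv 1 0 (x ∷ [])

  ∀-elim-□θ : ΓS ⊢ fm (all (□ᴹ (θ 0)) imp □ᴹ (θ 0))
  ∀-elim-□θ = ∀¹E (∀²E (axiom 10) (□ᴹ (θ 0))) 0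

  ∃-intro-□θ : ΓS ⊢ fm (□ᴹ (θ 0) imp ex (□ᴹ (θ 0)))
  ∃-intro-□θ = ∀¹E (∀²E (axiom 11) (□ᴹ (θ 0))) 0

  i-K : ΓS ⊢ TranslatedAxiom 17
  i-K = ∀²I (∀²I (discharge (□I₀ (deduction (□I₁ (deduction #1) #0)))))

  i-S : ΓS ⊢ TranslatedAxiom 18
  i-S = ∀²I (∀²I (∀²I (discharge (□I₀ (deduction (□I₁ (deduction
          (□I₂ (deduction (□E (□E #2 · #0) · (□E #1 · #0))) #1 #0)) #0))))))

  i-∧E₁ : ΓS ⊢ TranslatedAxiom 19
  i-∧E₁ = ∀²I (∀²I (discharge (□I₀ (deduction (∧E₁ (□E #0))))))

  i-∧E₂ : ΓS ⊢ TranslatedAxiom 20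
  i-∧E₂ = ∀²I (∀²I (discharge (□I₀ (deduction (∧E₂ (□E #0))))))

  i-∧I : ΓS ⊢ TranslatedAxiom 21
  i-∧I = ∀²I (∀²I (discharge (□I₀ (deduction (□I₁ (deduction (□I₂ (∧I #1 #0) #1 #0)) #0)))))

  i-∨I₁ : ΓS ⊢ TranslatedAxiom 22
  i-∨I₁ = ∀²I (∀²I (discharge (□I₀ (deduction (□I₁ (∨I₁ #0) #0)))))

  i-∨I₂ : ΓS ⊢ TranslatedAxiom 23
  i-∨I₂ = ∀²I (∀²I (discharge (□I₀ (deduction (□I₁ (∨I₂ #0) #0)))))

  i-∨E : ΓS ⊢ TranslatedAxiom 24
  i-∨E = ∀²I (∀²I (∀²I (discharge (□I₀ (deduction (□I₁ (deduction
           (□I₂ (deduction (∨E (□E #0) (□E #3 · #0) (□E #2 · #0))) #1 #0)) #0))))))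

  i-⊥E : ΓS ⊢ TranslatedAxiom 25
  i-⊥E = ∀²I (discharge (□I₀ (deduction (⊥E (□E #0)))))

  i-⊤I : ΓS ⊢ TranslatedAxiom 26
  i-⊤I = discharge (□I₀ ⊤I)

  i-∀E : ΓS ⊢ TranslatedAxiom 27
  i-∀E = ∀²I (∀¹I (discharge (□I₀ (deduction (theorem ∀-elim-□θ · □E #0)))))

  i-∃I : ΓS ⊢ TranslatedAxiom 28
  i-∃I = ∀²I (∀¹I (discharge (□I₀ (deduction (□I₁ (theorem ∃-intro-□θ · #0) #0)))))

  i-∀I : ΓS ⊢ TranslatedAxiom 29
  i-∀I = ∀²I (∀²I (discharge (□I₀ (deduction (□I₁ (deduction
           (□I₂ (theorem ∀-intro · (theorem ∀□⇒∀ · □E #1) · #0) #1 #0)) #0)))))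
    where
    B : Fm ⋆
    B = □ᴹ P imp □ᴹ (θ 0)
    ∀-intro : ΓS ⊢ fm (all B imp □ᴹ P imp all (□ᴹ (θ 0)))
    ∀-intro = ∀²E (∀²E (axiom 12) (□ᴹ P)) (□ᴹ (θ 0))
    ∀□⇒∀ : ΓS ⊢ fm (all (□ᴹ B) imp all B)
    ∀□⇒∀ = modusPonens
      (⟹E (∀²E (axiom 15) (all (□ᴹ B) imp B))
           (∀¹I (discharge (deduction (□E (theorem (∀¹E (∀²E (axiom 10) (□ᴹ B)) 0) · #0))))))
      (∀²E (∀²E (axiom 12) (all (□ᴹ B))) B)

  i-∃E : ΓS ⊢ TranslatedAxiom 30
  i-∃E = ∀²I (∀²I (discharge (□I₀ (deduction (□I₁ (deduction
           (theorem ∃-elim · (theorem ∀□⇒∀ · □E #1) · □E #0)) #0)))))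
    where
    B : Fm ⋆
    B = □ᴹ (θ 0) imp □ᴹ P
    ∃-elim : ΓS ⊢ fm (all B imp ex (□ᴹ (θ 0)) imp □ᴹ P)
    ∃-elim = ∀²E (∀²E (axiom 13) (□ᴹ (θ 0))) (□ᴹ P)
    ∀□⇒∀ : ΓS ⊢ fm (all (□ᴹ B) imp all B)
    ∀□⇒∀ = modusPonens
      (⟹E (∀²E (axiom 15) (all (□ᴹ B) imp B))
           (∀¹I (discharge (deduction (□E (theorem (∀¹E (∀²E (axiom 10) (□ᴹ B)) 0) · #0))))))
      (∀²E (∀²E (axiom 12) (all (□ᴹ B))) B)

  i-mp : ΓS ⊢ TranslatedAxiom 31
  i-mp = ∀²I (∀²I (⟹I (S4.modusPonens (&E₁ premises) (S4.modusPonens (&E₂ premises) (S4.□-T _)))))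
    where
    Premises : MF
    Premises = fm (□ᴹ P) & fm (□ᴹ (□ᴹ P imp □ᴹ (pv 0 1 [])))
    module S4 = S4Reasoning {Premises ∷ ΓS} (hyp (there (here refl)))
    premises : Premises ∷ ΓS ⊢ Premises
    premises = hyp (here refl)

  i-gen : ΓS ⊢ TranslatedAxiom 32
  i-gen = ∀²I (⟹I (S4.□-nec (⟹E (∀²E (S4.axiom 15) (□ᴹ (θ 0))) (hyp (here refl)))))
    where module S4 = S4Reasoning {∀¹ (fm (□ᴹ (θ 0))) ∷ ΓS} (hyp (there (here refl)))

  ?-∧ : ΓS ⊢ TranslatedAxiom 33
  ?-∧ = ∀²I (∀²I (discharge (⇔I (□E #0) (□I₂ (∧I #1 #0) (∧E₁ #0) (∧E₂ #0)))))

  ?-∨ : ΓS ⊢ TranslatedAxiom 34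
  ?-∨ = ∀²I (∀²I (discharge (⇔I (□E #0) (∨E #0 (□I₁ (∨I₁ #0) #0) (□I₁ (∨I₂ #0) #0)))))

  ?-→ : ΓS ⊢ TranslatedAxiom 35
  ?-→ = ∀²I (∀²I (discharge (deduction (□E #0))))

  ¬?⋏ : ΓS ⊢ TranslatedAxiom 36
  ¬?⋏ = discharge (deduction (□E #0))

  ?-∃ : ΓS ⊢ TranslatedAxiom 37
  ?-∃ = ∀²I (discharge (⇔I (□E #0) (theorem ∃□⇒□∃ · #0)))
    where
    ∃□⇒□∃ : ΓS ⊢ fm (ex (□ᴹ (θ 0)) imp □ᴹ (ex (□ᴹ (θ 0))))
    ∃□⇒□∃ = modusPonens
      (⟹E (∀²E (axiom 15) (□ᴹ (θ 0) imp □ᴹ (ex (□ᴹ (θ 0)))))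
           (∀¹I (discharge (deduction (□I₁ (theorem ∃-intro-□θ · #0) #0)))))
      (∀²E (∀²E (axiom 13) (□ᴹ (θ 0))) (□ᴹ (ex (□ᴹ (θ 0)))))

  ?-∀ : ΓS ⊢ TranslatedAxiom 38
  ?-∀ = ∀²I (discharge (deduction (□E #0)))

  !?-unit : ΓS ⊢ TranslatedAxiom 39
  !?-unit = ∀²I (discharge (□I₀ (deduction (□□I #0))))

  ¬!⊥ : ΓS ⊢ TranslatedAxiom 40
  ¬!⊥ = discharge (□I₀ (deduction #0))

  ?!-counit : ΓS ⊢ TranslatedAxiom 41
  ?!-counit = ∀²I (discharge (deduction (□E #0)))

  !-4 : ΓS ⊢ TranslatedAxiom 42
  !-4 = ∀²I (discharge (□I₀ (deduction (□□I #0))))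

  !-K : ΓS ⊢ TranslatedAxiom 43
  !-K = ∀²I (∀²I (discharge (□I₀ (deduction (□I₁ (deduction (□-app #1 #0)) #0)))))

  !-elim : ΓS ⊢ TranslatedAxiom 44
  !-elim = ∀²I (⟹I (S4.modusPonens (hyp (here refl)) (S4.□-T P)))
    where module S4 = S4Reasoning {fm (□ᴹ P) ∷ ΓS} (hyp (there (here refl)))

  !-intro : ΓS ⊢ TranslatedAxiom 45
  !-intro = ∀²I (⟹I (S4.□-nec (hyp (here refl))))
    where module S4 = S4Reasoning {fm P ∷ ΓS} (hyp (there (here refl)))

QS4⊢toS4-QHC-axioms : (MP.⋀ D-QS4 ∷ []) M.⊢ IntoS4.toS4-MF IntoS4.idEnv (HP.⋀ D-QHC)
QS4⊢toS4-QHC-axioms = MP.⊢-replaceTail 17 (M.hyp (here refl))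
  (  i-K ⊗ i-S ⊗ i-∧E₁ ⊗ i-∧E₂ ⊗ i-∧I ⊗ i-∨I₁ ⊗ i-∨I₂ ⊗ i-∨E ⊗ i-⊥E ⊗ i-⊤I
  ⊗ i-∀E ⊗ i-∃I ⊗ i-∀I ⊗ i-∃E ⊗ i-mp ⊗ i-gen
  ⊗ ?-∧ ⊗ ?-∨ ⊗ ?-→ ⊗ ¬?⋏ ⊗ ?-∃ ⊗ ?-∀ ⊗ !?-unit ⊗ ¬!⊥ ⊗ ?!-counit ⊗ !-4 ⊗ !-K ⊗ !-elim ⊗ !-intro)
  where
  open MP using (_⊗_)
  open TranslatedQHCAxioms

QHC-conservative-over-QS4 : ∀ R → (⊢QHC s4toH-RoP R) ⇔ (⊢QS4 R)
QHC-conservative-over-QS4 R = mk⇔ QHC⇒QS4 QS4⇒QHC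
  where
  open IntoS4 using (toS4-MF; idEnv; toS4-derivable; toS4-MF-QS4inQHC)
  open ≡-Reasoning

  QS4⇒QHC : ⊢QS4 R → ⊢QHC s4toH-RoP R
  QS4⇒QHC = subst ⊢QHC_ (QS4inQHC-trRoP R)
          ∘ QS4inQHC.tr-derivable D-QS4 D-QHC QHC⊢QS4inQHC-QS4-axioms R

  toS4-s4toH : toS4-MF idEnv (H.toMF (s4toH-RoP R)) ≡ M.toMF R
  toS4-s4toH = begin
    toS4-MF idEnv (H.toMF (s4toH-RoP R))       ≡⟨ cong (toS4-MF idEnv ∘ H.toMF) (QS4inQHC-trRoP R) ⟨
    toS4-MF idEnv (H.toMF (QS4inQHC.trRoP R))  ≡⟨ cong (toS4-MF idEnv) (QS4inQHC.trMF-toMF R) ⟨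
    toS4-MF idEnv (QS4inQHC.trMF (M.toMF R))   ≡⟨ toS4-MF-QS4inQHC (λ _ _ → refl) (M.toMF R) ⟩
    M.toMF R                                   ∎

  QHC⇒QS4 : ⊢QHC s4toH-RoP R → ⊢QS4 R
  QHC⇒QS4 = subst (M.Derivable D-QS4) toS4-s4toH
          ∘ toS4-derivable idEnv D-QHC D-QS4 QS4⊢toS4-QHC-axioms (H.toMF (s4toH-RoP R))

QS4-conservative-over-QC : ∀ R → (⊢QS4 QCinQS4.trRoP R) ⇔ (⊢QC R)
QS4-conservative-over-QC R = mk⇔ QS4⇒QC (QCinQS4.tr-derivable D-QC D-QS4 QS4⊢QCinQS4-QC-axioms R)
  where
  open ≡-Reasoning

  erase-embed : C.toMF (EraseBox.trRoP (QCinQS4.trRoP R)) ≡ C.toMF R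
  erase-embed = begin
    C.toMF (EraseBox.trRoP (QCinQS4.trRoP R))  ≡⟨ EraseBox.trMF-toMF (QCinQS4.trRoP R) ⟨
    EraseBox.trMF (M.toMF (QCinQS4.trRoP R))   ≡⟨ cong EraseBox.trMF (QCinQS4.trMF-toMF R) ⟨
    EraseBox.trMF (QCinQS4.trMF (C.toMF R))    ≡⟨ EraseBox-QCinQS4-MF (C.toMF R) ⟩
    C.toMF R                                   ∎

  QS4⇒QC : ⊢QS4 QCinQS4.trRoP R → ⊢QC R
  QS4⇒QC = subst (C.Derivable D-QC) erase-embed
         ∘ EraseBox.tr-derivable D-QS4 D-QC QC⊢EraseBox-QS4-axioms (QCinQS4.trRoP R)

mainTheorem2 : ((R : M.RoP) → (⊢QHC s4toH-RoP R) ⇔ (⊢QS4 R))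
                 × ((R : C.RoP) → (⊢QHC qctoH-RoP R) ⇔ (⊢QC R))
mainTheorem2 = QHC-conservative-over-QS4 , QHC-conservative-over-QC
  where
  QHC-conservative-over-QC : ∀ R → (⊢QHC qctoH-RoP R) ⇔ (⊢QC R)
  QHC-conservative-over-QC R = subst (λ R′ → (⊢QHC R′) ⇔ (⊢QC R)) (s4toH-RoP-QCinQS4 R)
    (QS4-conservative-over-QC R ⇔-∘ QHC-conservative-over-QS4 (QCinQS4.trRoP R))
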